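{- Let $n\in\mathbb{N}$ and $p$ any prime. Let $k$ be the smallest integer with $p^k>2^{2n}$, let $\tilde{\mathbb{F}}$ be the field of size $p^{2k}$ with subfield $\mathbb{F}$ of size $p^k$, and let $\beta\in\tilde{\mathbb{F}}\setminus\mathbb{F}$ be arbitrary. Then there exists $\boldsymbol{\alpha}\in\mathbb{F}^n$ such that for every polynomial $f_{\boldsymbol{\alpha}}(\mathbf{x},\mathbf{y})\in\tilde{\mathbb{F}}[x_1,\ldots,x_n,y_1,\ldots,y_n]$ agreeing with $1/(\sum_{i=1}^n\alpha_ix_iy_i-\beta)$ on $\{0,1\}^{2n}$, any $\mathrm{roABP}$ computing $f_{\boldsymbol{\alpha}}$ in any variable order in which all $\mathbf{x}$ variables precede all $\mathbf{y}$ variables has width at least $2^n$.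
   Context: An $\mathrm{roABP}$ in variable order $\pi$ on variables $w_1,\ldots,w_M$ is a directed acyclic graph with vertex layers $V_0=\{s\},V_1,\ldots,V_M=\{t\}$, with edges only from $V_{i-1}$ to $V_i$, each labelled by a univariate polynomial in $w_{\pi(i)}$; it computes the sum over all $s$-$t$ paths of the product of the edge labels. Its width is $\max_i|V_i|$. -}

module Defs where

open import Level using (0ℓ)
open import Data.Nat using (ℕ; zero; suc; _<_; _⊔_)
open import Data.Fin using (Fin; zero; suc)
open import Data.Bool using (Bool; true; false)
open import Data.List using (List; []; _∷_)
open import Data.Product using (Σ; ∃; _×_; _,_)
open import Relation.Nullary using (¬_)
open import Relation.Binary.PropositionalEquality using (_≡_)
open import Algebra.Bundles using (CommutativeRing)
import Data.Fin
import Data.Fin.Permutation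

-- Fields (not in agda-stdlib): a commutative ring with 0 ≉ 1 in which
-- every nonzero element has a multiplicative inverse.  The inverse is a
-- total operation whose value at 0 is irrelevant.

record Field : Set₁ where
  field
    commutativeRing : CommutativeRing 0ℓ 0ℓ
  open CommutativeRing commutativeRing public
  field
    _⁻¹       : Carrier → Carrier
    0≉1       : ¬ (0# ≈ 1#)
    ⁻¹-inverse : ∀ x → ¬ (x ≈ 0#) → (x * (x ⁻¹)) ≈ 1#

module _ (F : Field) where
  open Field F hiding (zero)

  HasSize : ℕ → Set
  HasSize N = Σ (Fin N → Carrier) λ e →
    (∀ i j → e i ≈ e j → i ≡ j) × (∀ x → ∃ λ i → e i ≈ x)

  record IsSubfieldOfSize (S : Carrier → Set) (N : ℕ) : Set where
    field
      resp  : ∀ {x y} → x ≈ y → S x → S y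
      has0  : S 0#
      has1  : S 1#
      plus  : ∀ {x y} → S x → S y → S (x + y)
      neg   : ∀ {x} → S x → S (- x)
      times : ∀ {x y} → S x → S y → S (x * y)
      inv   : ∀ {x} → S x → ¬ (x ≈ 0#) → S (x ⁻¹)
      enum       : Fin N → Carrier
      enum-in    : ∀ i → S (enum i)
      enum-inj   : ∀ i j → enum i ≈ enum j → i ≡ j
      enum-surj  : ∀ x → S x → ∃ λ i → enum i ≈ x

  sumFin : (m : ℕ) → (Fin m → Carrier) → Carrier
  sumFin zero    g = 0#
  sumFin (suc m) g = g zero + sumFin m (λ i → g (suc i))

  prodFin : (m : ℕ) → (Fin m → Carrier) → Carrier
  prodFin zero    g = 1#
  prodFin (suc m) g = g zero * prodFin m (λ i → g (suc i))

  pow : Carrier → ℕ → Carrier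
  pow x zero    = 1#
  pow x (suc d) = x * pow x d

  -- Univariate polynomials: coefficient lists (constant term first).
  UPoly : Set
  UPoly = List Carrier

  ucoeff : UPoly → ℕ → Carrier
  ucoeff []       d       = 0#
  ucoeff (a ∷ as) zero    = a
  ucoeff (a ∷ as) (suc d) = ucoeff as d

  record MPoly (M : ℕ) : Set where
    field
      D      : ℕ
      coeff  : (Fin M → ℕ) → Carrier
      bound  : ∀ e j → D < e j → coeff e ≈ 0#

  consF : {m : ℕ} → ℕ → (Fin m → ℕ) → Fin (suc m) → ℕ
  consF d e zero    = d
  consF d e (suc j) = e j

  sumExps : (D m : ℕ) → ((Fin m → ℕ) → Carrier) → Carrier
  sumExps D zero    g = g (λ ())
  sumExps D (suc m) g =
    sumFin (suc D) (λ d → sumExps D m (λ e → g (consF (Data.Fin.toℕ d) e)))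

  bit : Bool → Carrier
  bit true  = 1#
  bit false = 0#

  evalMP : {M : ℕ} → MPoly M → (Fin M → Carrier) → Carrier
  evalMP {M} f a = sumExps (MPoly.D f) M
    (λ e → MPoly.coeff f e * prodFin M (λ j → pow (a j) (e j)))

  -- Layered ABP: 'Layers a m' has m edge layers, first vertex layer of
  -- size a, last vertex layer of size 1.  Layer l goes from V_{l} to
  -- V_{l+1}; the edge label between u and v is a univariate polynomial
  -- (a missing edge is the zero polynomial []).
  data Layers : ℕ → ℕ → Set where
    end  : Layers 1 zero
    step : {a b m : ℕ} → (Fin a → Fin b → UPoly) → Layers b m → Layers a (suc m)

  ROABP : ℕ → Set
  ROABP M = Layers 1 M

  width : {a m : ℕ} → Layers a m → ℕ
  width end                  = 1
  width (step {a = a} A L)   = a ⊔ width L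

  -- Since every layer reads a single variable and
  -- each variable is read in exactly one layer, this is the coefficient
  -- of the corresponding monomial in the polynomial computed.
  pathCoeff : {a m : ℕ} → Layers a m → (Fin m → ℕ) → Fin a → Carrier
  pathCoeff end        d u = 1#
  pathCoeff (step {b = b} A L) d u =
    sumFin b (λ v → ucoeff (A u v) (d zero) * pathCoeff L (λ l → d (suc l)) v)

  -- The roABP L in variable order π (layer l reads variable π(l))
  -- computes the polynomial f.
  Computes : {M : ℕ} → ROABP M → Data.Fin.Permutation.Permutation′ M → MPoly M → Set
  Computes {M} L π f = ∀ (e : Fin M → ℕ) →
    pathCoeff L (λ l → e (π Data.Fin.Permutation.⟨$⟩ʳ l)) zero ≈ MPoly.coeff f e

-- Cutting the roABP after its x-layers writes f as Σ_{v ∈ V_n} g_v(x) h_v(y), so the matrix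
-- (f(u, w))_{u, w ∈ {0,1}ⁿ} factors through 𝔽̃^{|V_n|}. On Boolean points f(u, w) = k(u ∧ w) with
-- k(U) = (Σ_{i ∈ U} α_i − β)⁻¹, and such a meet matrix has linearly independent rows as soon as
-- every Möbius coefficient Σ_{U ⊆ T} (−1)^{|T∖U|} k(U) is nonzero; then |V_n| ≥ 2ⁿ.
-- α is built one coordinate at a time. Appending a to α keeps the old Möbius coefficients and
-- adds φ_T(a) − μ_T, where φ_T is a sum of 2^t simple fractions with poles β − Σ_{i∈U} α_i ∉ 𝔽.
-- So each T excludes at most 2^t values a ∈ 𝔽, and |𝔽| > 2^{2n} leaves an admissible one.

module Submission where

open import Algebra.Bundles using (CommutativeRing)
open import Algebra.Solver.Ring.AlmostCommutativeRing
  using (AlmostCommutativeRing; fromCommutativeRing; _-Raw-AlmostCommutative⟶_)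
open import Data.Bool using (Bool; true; false; _∧_)
open import Data.Empty using (⊥; ⊥-elim)
open import Data.Fin as Fin using (Fin; zero; suc; _↑ˡ_; _↑ʳ_; splitAt; punchIn; punchOut)
import Data.Fin.Properties as FinP
open import Data.Fin.Permutation as Perm using (Permutation′; _⟨$⟩ʳ_; _⟨$⟩ˡ_)
open import Data.Integer as ℤ using (ℤ; +_; -[1+_])
import Data.Integer.Properties as ℤP
open import Data.List using ([]; _∷_)
open import Data.Maybe using (Maybe; just; nothing)
open import Data.Nat as ℕ using (ℕ; zero; suc; _≤_; _<_; s≤s; z≤n)
import Data.Nat.Properties as ℕP
open import Data.Nat.Primality using (Prime)
open import Data.Product using (Σ; ∃; _×_; _,_; proj₁; proj₂)
open import Data.Sign as Sign using (Sign)
open import Data.Sum using (inj₁; inj₂; [_,_]′)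
open import Data.Vec using (Vec; []; _∷_; _++_; zipWith; lookup)
open import Data.Vec.Properties using (lookup-++ˡ; lookup-++ʳ)
open import Function using (_∘_)
open import Function.Bundles using (Injection)
open import Function.Properties.Inverse using (Inverse⇒Injection)
open import Relation.Binary.PropositionalEquality as ≡ using (_≡_; _≢_)
open import Relation.Nullary using (¬_; Dec; yes; no)
open import Relation.Nullary.Decidable using (¬?; decidable-stable)
open import Relation.Nullary.Negation using (contradiction)

open import Defs

module IntegerCoefficientSolver {c ℓ} (R : CommutativeRing c ℓ) where
  open CommutativeRing R
  open import Algebra.Properties.Ring ring using (-‿involutive; -‿distribˡ-*; -‿+-comm; -0#≈0#)
  open import Algebra.Properties.Semiring.Mult.TCOptimised semiring
    using (×-homo-+; ×1-homo-*; 1+×) renaming (_×_ to _·_)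
  open import Relation.Binary.Reasoning.Setoid setoid

  private
    ⟦_⟧ : ℤ → Carrier
    ⟦ + n ⟧      = n · 1#
    ⟦ -[1+ n ] ⟧ = - (suc n · 1#)

    1+a-1+b≈a-b : ∀ a b → (1# + a) - (1# + b) ≈ a - b
    1+a-1+b≈a-b a b = begin
      (1# + a) + - (1# + b)   ≈⟨ +-congˡ (-‿+-comm 1# b) ⟨
      (1# + a) + (- 1# + - b) ≈⟨ +-assoc _ _ _ ⟩
      1# + (a + (- 1# + - b)) ≈⟨ +-congˡ (+-assoc _ _ _) ⟨
      1# + ((a + - 1#) + - b) ≈⟨ +-congˡ (+-congʳ (+-comm _ _)) ⟩
      1# + ((- 1# + a) + - b) ≈⟨ +-congˡ (+-assoc _ _ _) ⟩
      1# + (- 1# + (a - b))   ≈⟨ +-assoc _ _ _ ⟨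
      (1# + - 1#) + (a - b)   ≈⟨ +-congʳ (-‿inverseʳ 1#) ⟩
      0# + (a - b)            ≈⟨ +-identityˡ _ ⟩
      a - b                   ∎

    ⊖-homo : ∀ m n → ⟦ m ℤ.⊖ n ⟧ ≈ m · 1# - n · 1#
    ⊖-homo m zero = begin
      ⟦ m ℤ.⊖ 0 ⟧  ≡⟨ ≡.cong ⟦_⟧ (ℤP.⊖-≥ {m} {0} ℕ.z≤n) ⟩
      m · 1#       ≈⟨ +-identityʳ _ ⟨
      m · 1# + 0#  ≈⟨ +-congˡ -0#≈0# ⟨
      m · 1# - 0#  ∎
    ⊖-homo zero    (suc n) = sym (+-identityˡ _)
    ⊖-homo (suc m) (suc n) = begin
      ⟦ suc m ℤ.⊖ suc n ⟧              ≡⟨ ≡.cong ⟦_⟧ (ℤP.[1+m]⊖[1+n]≡m⊖n m n) ⟩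
      ⟦ m ℤ.⊖ n ⟧                      ≈⟨ ⊖-homo m n ⟩
      m · 1# - n · 1#                  ≈⟨ 1+a-1+b≈a-b _ _ ⟨
      (1# + m · 1#) - (1# + n · 1#)    ≈⟨ +-cong (1+× m 1#) (-‿cong (1+× n 1#)) ⟨
      suc m · 1# - suc n · 1#          ∎

    +-homo : ∀ i j → ⟦ i ℤ.+ j ⟧ ≈ ⟦ i ⟧ + ⟦ j ⟧
    +-homo (+ m)      (+ n)      = ×-homo-+ 1# m n
    +-homo (+ m)      -[1+ n ]   = ⊖-homo m (suc n)
    +-homo -[1+ m ]   (+ n)      = trans (⊖-homo n (suc m)) (+-comm _ _)
    +-homo -[1+ m ]   -[1+ n ]   = begin
      - (suc (suc m ℕ.+ n) · 1#)         ≈⟨ -‿cong (1+× (suc m ℕ.+ n) 1#) ⟩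
      - (1# + (suc m ℕ.+ n) · 1#)        ≈⟨ -‿cong (+-congˡ (×-homo-+ 1# (suc m) n)) ⟩
      - (1# + (suc m · 1# + n · 1#))     ≈⟨ -‿cong (+-assoc _ _ _) ⟨
      - ((1# + suc m · 1#) + n · 1#)     ≈⟨ -‿cong (+-congʳ (+-comm _ _)) ⟩
      - ((suc m · 1# + 1#) + n · 1#)     ≈⟨ -‿cong (+-assoc _ _ _) ⟩
      - (suc m · 1# + (1# + n · 1#))     ≈⟨ -‿cong (+-congˡ (1+× n 1#)) ⟨
      - (suc m · 1# + suc n · 1#)        ≈⟨ -‿+-comm _ _ ⟨
      - (suc m · 1#) + - (suc n · 1#)    ∎

    -‿homo : ∀ i → ⟦ ℤ.- i ⟧ ≈ - ⟦ i ⟧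
    -‿homo (+ zero)  = sym -0#≈0#
    -‿homo (+ suc n) = refl
    -‿homo -[1+ n ]  = sym (-‿involutive _)

    ⟦_⟧ₛ : Sign → Carrier
    ⟦ Sign.+ ⟧ₛ = 1#
    ⟦ Sign.- ⟧ₛ = - 1#

    ◃-homo : ∀ s n → ⟦ s ℤ.◃ n ⟧ ≈ ⟦ s ⟧ₛ * (n · 1#)
    ◃-homo Sign.+ zero    = sym (zeroʳ _)
    ◃-homo Sign.- zero    = sym (zeroʳ _)
    ◃-homo Sign.+ (suc n) = sym (*-identityˡ _)
    ◃-homo Sign.- (suc n) = trans (-‿cong (sym (*-identityˡ _))) (-‿distribˡ-* 1# _)

    sign◃abs : ∀ i → ⟦ i ⟧ ≈ ⟦ ℤ.sign i ⟧ₛ * (ℤ.∣ i ∣ · 1#)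
    sign◃abs (+ n)      = sym (*-identityˡ _)
    sign◃abs -[1+ n ]   = ◃-homo Sign.- (suc n)

    sign-homo : ∀ s t → ⟦ s Sign.* t ⟧ₛ ≈ ⟦ s ⟧ₛ * ⟦ t ⟧ₛ
    sign-homo Sign.+ t      = sym (*-identityˡ _)
    sign-homo Sign.- Sign.+ = sym (*-identityʳ _)
    sign-homo Sign.- Sign.- = begin
      1#              ≈⟨ -‿involutive 1# ⟨
      - - 1#          ≈⟨ -‿cong (*-identityˡ _) ⟨
      - (1# * - 1#)   ≈⟨ -‿distribˡ-* 1# (- 1#) ⟩
      - 1# * - 1#     ∎

    *-interchange : ∀ a b c d → (a * b) * (c * d) ≈ (a * c) * (b * d)
    *-interchange a b c d = begin
      (a * b) * (c * d) ≈⟨ *-assoc _ _ _ ⟩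
      a * (b * (c * d)) ≈⟨ *-congˡ (*-assoc _ _ _) ⟨
      a * ((b * c) * d) ≈⟨ *-congˡ (*-congʳ (*-comm _ _)) ⟩
      a * ((c * b) * d) ≈⟨ *-congˡ (*-assoc _ _ _) ⟩
      a * (c * (b * d)) ≈⟨ *-assoc _ _ _ ⟨
      (a * c) * (b * d) ∎

    *-homo : ∀ i j → ⟦ i ℤ.* j ⟧ ≈ ⟦ i ⟧ * ⟦ j ⟧
    *-homo i j = begin
      ⟦ i ℤ.* j ⟧
        ≈⟨ ◃-homo (ℤ.sign i Sign.* ℤ.sign j) (ℤ.∣ i ∣ ℕ.* ℤ.∣ j ∣) ⟩
      ⟦ ℤ.sign i Sign.* ℤ.sign j ⟧ₛ * ((ℤ.∣ i ∣ ℕ.* ℤ.∣ j ∣) · 1#)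
        ≈⟨ *-cong (sign-homo (ℤ.sign i) (ℤ.sign j)) (×1-homo-* ℤ.∣ i ∣ ℤ.∣ j ∣) ⟩
      (⟦ ℤ.sign i ⟧ₛ * ⟦ ℤ.sign j ⟧ₛ) * ((ℤ.∣ i ∣ · 1#) * (ℤ.∣ j ∣ · 1#))
        ≈⟨ *-interchange _ _ _ _ ⟩
      (⟦ ℤ.sign i ⟧ₛ * (ℤ.∣ i ∣ · 1#)) * (⟦ ℤ.sign j ⟧ₛ * (ℤ.∣ j ∣ · 1#))
        ≈⟨ *-cong (sign◃abs i) (sign◃abs j) ⟨
      ⟦ i ⟧ * ⟦ j ⟧ ∎

  almostCommutativeRing : AlmostCommutativeRing c ℓ
  almostCommutativeRing = fromCommutativeRing R

  ℤ-homomorphism : ℤ.+-*-rawRing -Raw-AlmostCommutative⟶ almostCommutativeRing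
  ℤ-homomorphism = record
    { ⟦_⟧ = ⟦_⟧ ; +-homo = +-homo ; *-homo = *-homo ; -‿homo = -‿homo
    ; 0-homo = refl ; 1-homo = refl }

  private
    ⟦⟧-dec : ∀ i j → Maybe (⟦ i ⟧ ≈ ⟦ j ⟧)
    ⟦⟧-dec i j with i ℤ.≟ j
    ... | yes ≡.refl = just refl
    ... | no _       = nothing

  open import Algebra.Solver.Ring ℤ.+-*-rawRing almostCommutativeRing ℤ-homomorphism ⟦⟧-dec public

module FieldProperties (F : Field) where
  open Field F hiding (zero)
  open IntegerCoefficientSolver commutativeRing
  open import Relation.Binary.Reasoning.Setoid setoid

  ⁻¹-inverseˡ : ∀ x → x ≉ 0# → x ⁻¹ * x ≈ 1#
  ⁻¹-inverseˡ x x≉0 = trans (*-comm _ _) (⁻¹-inverse x x≉0)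

  x*y≈0⇒y≈0 : ∀ x y → x ≉ 0# → x * y ≈ 0# → y ≈ 0#
  x*y≈0⇒y≈0 x y x≉0 xy≈0 = begin
    y                  ≈⟨ *-identityˡ y ⟨
    1# * y             ≈⟨ *-congʳ (⁻¹-inverseˡ x x≉0) ⟨
    (x ⁻¹ * x) * y     ≈⟨ *-assoc _ _ _ ⟩
    x ⁻¹ * (x * y)     ≈⟨ *-congˡ xy≈0 ⟩
    x ⁻¹ * 0#          ≈⟨ zeroʳ _ ⟩
    0#                 ∎

  x*y≈0⇒x≈0 : ∀ x y → y ≉ 0# → x * y ≈ 0# → x ≈ 0#
  x*y≈0⇒x≈0 x y y≉0 xy≈0 = x*y≈0⇒y≈0 y x y≉0 (trans (*-comm _ _) xy≈0)

  *-nonzero : ∀ {x y} → x ≉ 0# → y ≉ 0# → x * y ≉ 0#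
  *-nonzero {x} {y} x≉0 y≉0 xy≈0 = y≉0 (x*y≈0⇒y≈0 x y x≉0 xy≈0)

  ⁻¹-nonzero : ∀ x → x ≉ 0# → x ⁻¹ ≉ 0#
  ⁻¹-nonzero x x≉0 x⁻¹≈0 = 0≉1 (begin
    0#          ≈⟨ zeroʳ x ⟨
    x * 0#      ≈⟨ *-congˡ x⁻¹≈0 ⟨
    x * x ⁻¹    ≈⟨ ⁻¹-inverse x x≉0 ⟩
    1#          ∎)

  ⁻¹-cong : ∀ {x y} → x ≈ y → x ≉ 0# → x ⁻¹ ≈ y ⁻¹
  ⁻¹-cong {x} {y} x≈y x≉0 = begin
    x ⁻¹                ≈⟨ *-identityʳ _ ⟨
    x ⁻¹ * 1#           ≈⟨ *-congˡ (⁻¹-inverse y y≉0) ⟨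
    x ⁻¹ * (y * y ⁻¹)   ≈⟨ *-assoc _ _ _ ⟨
    (x ⁻¹ * y) * y ⁻¹   ≈⟨ *-congʳ (*-congˡ x≈y) ⟨
    (x ⁻¹ * x) * y ⁻¹   ≈⟨ *-congʳ (⁻¹-inverseˡ x x≉0) ⟩
    1# * y ⁻¹           ≈⟨ *-identityˡ _ ⟩
    y ⁻¹                ∎
    where
    y≉0 : y ≉ 0#
    y≉0 y≈0 = x≉0 (trans x≈y y≈0)

  x-y≈0⇒x≈y : ∀ x y → x - y ≈ 0# → x ≈ y
  x-y≈0⇒x≈y x y x-y≈0 = begin
    x              ≈⟨ solve 2 (λ x y → x := (x :- y) :+ y) refl x y ⟩
    (x - y) + y    ≈⟨ +-congʳ x-y≈0 ⟩
    0# + y         ≈⟨ +-identityˡ y ⟩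
    y              ∎

  sumFin-cong : ∀ m {g h : Fin m → Carrier} → (∀ i → g i ≈ h i) → sumFin F m g ≈ sumFin F m h
  sumFin-cong zero    g≈h = refl
  sumFin-cong (suc m) g≈h = +-cong (g≈h zero) (sumFin-cong m (g≈h ∘ suc))

  sumFin-zero : ∀ m {g : Fin m → Carrier} → (∀ i → g i ≈ 0#) → sumFin F m g ≈ 0#
  sumFin-zero zero    g≈0 = refl
  sumFin-zero (suc m) g≈0 = trans (+-cong (g≈0 zero) (sumFin-zero m (g≈0 ∘ suc))) (+-identityˡ _)

  sumFin-+ : ∀ m (g h : Fin m → Carrier) →
    sumFin F m (λ i → g i + h i) ≈ sumFin F m g + sumFin F m h
  sumFin-+ zero    g h = sym (+-identityˡ _)
  sumFin-+ (suc m) g h = trans (+-congˡ (sumFin-+ m _ _))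
    (solve 4 (λ a b c d → (a :+ b) :+ (c :+ d) := (a :+ c) :+ (b :+ d)) refl _ _ _ _)

  sumFin-sub : ∀ m (g h : Fin m → Carrier) →
    sumFin F m (λ i → g i - h i) ≈ sumFin F m g - sumFin F m h
  sumFin-sub zero    g h = sym (-‿inverseʳ 0#)
  sumFin-sub (suc m) g h = trans (+-congˡ (sumFin-sub m _ _))
    (solve 4 (λ a b c d → (a :- b) :+ (c :- d) := (a :+ c) :- (b :+ d)) refl _ _ _ _)

  *-distribˡ-sumFin : ∀ m c (g : Fin m → Carrier) →
    sumFin F m (λ i → c * g i) ≈ c * sumFin F m g
  *-distribˡ-sumFin zero    c g = sym (zeroʳ c)
  *-distribˡ-sumFin (suc m) c g = trans (+-congˡ (*-distribˡ-sumFin m c _)) (sym (distribˡ _ _ _))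

  *-distribʳ-sumFin : ∀ m c (g : Fin m → Carrier) →
    sumFin F m (λ i → g i * c) ≈ sumFin F m g * c
  *-distribʳ-sumFin m c g =
    trans (sumFin-cong m (λ i → *-comm _ _)) (trans (*-distribˡ-sumFin m c g) (*-comm _ _))

  sumFin-swap : ∀ m k (g : Fin m → Fin k → Carrier) →
    sumFin F m (λ i → sumFin F k (g i)) ≈ sumFin F k (λ j → sumFin F m (λ i → g i j))
  sumFin-swap zero    k g = sym (sumFin-zero k (λ j → refl))
  sumFin-swap (suc m) k g = begin
    sumFin F k (g zero) + sumFin F m (λ i → sumFin F k (g (suc i)))
      ≈⟨ +-congˡ (sumFin-swap m k (g ∘ suc)) ⟩
    sumFin F k (g zero) + sumFin F k (λ j → sumFin F m (λ i → g (suc i) j))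
      ≈⟨ sumFin-+ k _ _ ⟨
    sumFin F k (λ j → g zero j + sumFin F m (λ i → g (suc i) j)) ∎

  sumFin-++ : ∀ m₁ m₂ (g : Fin (m₁ ℕ.+ m₂) → Carrier) →
    sumFin F (m₁ ℕ.+ m₂) g
      ≈ sumFin F m₁ (λ i → g (i ↑ˡ m₂)) + sumFin F m₂ (λ j → g (m₁ ↑ʳ j))
  sumFin-++ zero     m₂ g = sym (+-identityˡ _)
  sumFin-++ (suc m₁) m₂ g = trans (+-congˡ (sumFin-++ m₁ m₂ (g ∘ suc))) (sym (+-assoc _ _ _))

  prodFin-cong : ∀ m {g h : Fin m → Carrier} → (∀ i → g i ≈ h i) → prodFin F m g ≈ prodFin F m h
  prodFin-cong zero    g≈h = refl
  prodFin-cong (suc m) g≈h = *-cong (g≈h zero) (prodFin-cong m (g≈h ∘ suc))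

  prodFin-++ : ∀ m₁ m₂ (g : Fin (m₁ ℕ.+ m₂) → Carrier) →
    prodFin F (m₁ ℕ.+ m₂) g
      ≈ prodFin F m₁ (λ i → g (i ↑ˡ m₂)) * prodFin F m₂ (λ j → g (m₁ ↑ʳ j))
  prodFin-++ zero     m₂ g = sym (*-identityˡ _)
  prodFin-++ (suc m₁) m₂ g = trans (*-congˡ (prodFin-++ m₁ m₂ (g ∘ suc))) (sym (*-assoc _ _ _))

  -- sumExps F D (suc m) g unfolds to sumFin F (suc D) (slice D g); Agda cannot infer these
  -- slices as implicit arguments of sumFin-cong by itself.
  private
    slice : ∀ D {m} → ((Fin (suc m) → ℕ) → Carrier) → Fin (suc D) → Carrier
    slice D {m} g d = sumExps F D m (λ e → g (consF F (Fin.toℕ d) e))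

  sumExps-cong : ∀ D m {g h : (Fin m → ℕ) → Carrier} → (∀ e → g e ≈ h e) →
    sumExps F D m g ≈ sumExps F D m h
  sumExps-cong D zero    g≈h = g≈h _
  sumExps-cong D (suc m) {g} {h} g≈h =
    sumFin-cong (suc D) {slice D g} {slice D h} (λ d → sumExps-cong D m (λ e → g≈h _))

  *-distribˡ-sumExps : ∀ D m c (g : (Fin m → ℕ) → Carrier) →
    sumExps F D m (λ e → c * g e) ≈ c * sumExps F D m g
  *-distribˡ-sumExps D zero    c g = refl
  *-distribˡ-sumExps D (suc m) c g = trans
    (sumFin-cong (suc D) {slice D (λ e → c * g e)} {λ d → c * slice D g d}
      (λ d → *-distribˡ-sumExps D m c _))
    (*-distribˡ-sumFin (suc D) c (slice D g))

  sumExps-sumFin : ∀ D m b (h : (Fin m → ℕ) → Fin b → Carrier) →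
    sumExps F D m (λ e → sumFin F b (h e)) ≈ sumFin F b (λ v → sumExps F D m (λ e → h e v))
  sumExps-sumFin D zero    b h = refl
  sumExps-sumFin D (suc m) b h = trans
    (sumFin-cong (suc D) {slice D (λ e → sumFin F b (h e))} {λ d → sumFin F b (λ v → slice D (λ e → h e v) d)}
      (λ d → sumExps-sumFin D m b _))
    (sumFin-swap (suc D) b (λ d v → slice D (λ e → h e v) d))

  Extensional : ∀ {m} → ((Fin m → ℕ) → Carrier) → Set
  Extensional g = ∀ e e′ → (∀ i → e i ≡ e′ i) → g e ≈ g e′

  sumExps-++ : ∀ D m₁ m₂ (g₁ : (Fin m₁ → ℕ) → Carrier) (g₂ : (Fin m₂ → ℕ) → Carrier) →
    Extensional g₁ →
    sumExps F D (m₁ ℕ.+ m₂) (λ e → g₁ (λ i → e (i ↑ˡ m₂)) * g₂ (λ j → e (m₁ ↑ʳ j)))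
      ≈ sumExps F D m₁ g₁ * sumExps F D m₂ g₂
  sumExps-++ D zero m₂ g₁ g₂ g₁-ext = trans
    (sumExps-cong D m₂ (λ e → *-congʳ (g₁-ext _ _ (λ ()))))
    (*-distribˡ-sumExps D m₂ _ g₂)
  sumExps-++ D (suc m₁) m₂ g₁ g₂ g₁-ext = trans
    (sumFin-cong (suc D)
      {slice D (λ e → g₁ (λ i → e (i ↑ˡ m₂)) * g₂ (λ j → e (suc m₁ ↑ʳ j)))}
      {λ d → slice D g₁ d * sumExps F D m₂ g₂}
      (λ d → trans
        (sumExps-cong D (m₁ ℕ.+ m₂) (λ e →
          *-congʳ (g₁-ext _ _ (λ { zero → ≡.refl ; (suc i) → ≡.refl }))))
        (sumExps-++ D m₁ m₂ _ g₂ (λ e e′ e≗e′ →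
          g₁-ext _ _ (λ { zero → ≡.refl ; (suc i) → e≗e′ i })))))
    (*-distribʳ-sumFin (suc D) _ (slice D g₁))

  finite⇒decidable : ∀ {N} → HasSize F N → ∀ x y → Dec (x ≈ y)
  finite⇒decidable (e , e-injective , e-surjective) x y
    with e-surjective x | e-surjective y
  ... | i , eᵢ≈x | j , eⱼ≈y with i Fin.≟ j
  ... | yes ≡.refl = yes (trans (sym eᵢ≈x) eⱼ≈y)
  ... | no  i≢j    = no λ x≈y → i≢j (e-injective i j (trans eᵢ≈x (trans x≈y (sym eⱼ≈y))))

  RowsIndependent : ∀ {N} {W : Set} → (Fin N → W → Carrier) → Set
  RowsIndependent {N} M =
    (c : Fin N → Carrier) → (∀ w → sumFin F N (λ i → c i * M i w) ≈ 0#) → ∀ i → c i ≈ 0#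

-- 2^t, with a recursion that matches splitAt
pow2 : ℕ → ℕ
pow2 zero    = 1
pow2 (suc t) = pow2 t ℕ.+ pow2 t

pow2≡2^ : ∀ t → pow2 t ≡ 2 ℕ.^ t
pow2≡2^ zero    = ≡.refl
pow2≡2^ (suc t) = ≡.cong₂ ℕ._+_ (pow2≡2^ t) (≡.trans (pow2≡2^ t) (≡.sym (ℕP.+-identityʳ (2 ℕ.^ t))))

enumCube : ∀ t → Fin (pow2 t) → Vec Bool t
enumCube zero    _ = []
enumCube (suc t) i = [ (false ∷_) ∘ enumCube t , (true ∷_) ∘ enumCube t ]′ (splitAt (pow2 t) i)

indexCube : ∀ t → Vec Bool t → Fin (pow2 t)
indexCube zero    []          = zero
indexCube (suc t) (false ∷ u) = indexCube t u ↑ˡ pow2 t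
indexCube (suc t) (true  ∷ u) = pow2 t ↑ʳ indexCube t u

enumCube-↑ˡ : ∀ t i → enumCube (suc t) (i ↑ˡ pow2 t) ≡ false ∷ enumCube t i
enumCube-↑ˡ t i rewrite FinP.splitAt-↑ˡ (pow2 t) i (pow2 t) = ≡.refl

enumCube-↑ʳ : ∀ t i → enumCube (suc t) (pow2 t ↑ʳ i) ≡ true ∷ enumCube t i
enumCube-↑ʳ t i rewrite FinP.splitAt-↑ʳ (pow2 t) (pow2 t) i = ≡.refl

enumCube-index : ∀ t u → enumCube t (indexCube t u) ≡ u
enumCube-index zero    []          = ≡.refl
enumCube-index (suc t) (false ∷ u) =
  ≡.trans (enumCube-↑ˡ t (indexCube t u)) (≡.cong (false ∷_) (enumCube-index t u))
enumCube-index (suc t) (true  ∷ u) =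
  ≡.trans (enumCube-↑ʳ t (indexCube t u)) (≡.cong (true ∷_) (enumCube-index t u))

index-enumCube : ∀ t i → indexCube t (enumCube t i) ≡ i
index-enumCube zero    zero = ≡.refl
index-enumCube (suc t) i with splitAt (pow2 t) i in eq
... | inj₁ j = ≡.trans (≡.cong (_↑ˡ pow2 t) (index-enumCube t j)) (FinP.splitAt⁻¹-↑ˡ eq)
... | inj₂ j = ≡.trans (≡.cong (pow2 t ↑ʳ_) (index-enumCube t j)) (FinP.splitAt⁻¹-↑ʳ eq)

module CubeSums (F : Field) where
  open Field F hiding (zero)
  open IntegerCoefficientSolver commutativeRing
  open FieldProperties F
  open import Relation.Binary.Reasoning.Setoid setoid

  sumCube : ∀ t → (Vec Bool t → Carrier) → Carrier
  sumCube zero    g = g []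
  sumCube (suc t) g = sumCube t (g ∘ (false ∷_)) + sumCube t (g ∘ (true ∷_))

  sumCube-cong : ∀ t {g h : Vec Bool t → Carrier} → (∀ u → g u ≈ h u) → sumCube t g ≈ sumCube t h
  sumCube-cong zero    g≈h = g≈h []
  sumCube-cong (suc t) g≈h = +-cong (sumCube-cong t (g≈h ∘ (false ∷_))) (sumCube-cong t (g≈h ∘ (true ∷_)))

  sumCube-zero : ∀ t → sumCube t (λ _ → 0#) ≈ 0#
  sumCube-zero zero    = refl
  sumCube-zero (suc t) = trans (+-cong (sumCube-zero t) (sumCube-zero t)) (+-identityˡ _)

  sumCube-+ : ∀ t (g h : Vec Bool t → Carrier) →
    sumCube t (λ u → g u + h u) ≈ sumCube t g + sumCube t h
  sumCube-+ zero    g h = refl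
  sumCube-+ (suc t) g h = trans (+-cong (sumCube-+ t _ _) (sumCube-+ t _ _))
    (solve 4 (λ a b c d → (a :+ b) :+ (c :+ d) := (a :+ c) :+ (b :+ d)) refl _ _ _ _)

  sumCube-sub : ∀ t (g h : Vec Bool t → Carrier) →
    sumCube t (λ u → g u - h u) ≈ sumCube t g - sumCube t h
  sumCube-sub zero    g h = refl
  sumCube-sub (suc t) g h = trans (+-cong (sumCube-sub t _ _) (sumCube-sub t _ _))
    (solve 4 (λ a b c d → (a :- b) :+ (c :- d) := (a :+ c) :- (b :+ d)) refl _ _ _ _)

  sumCube≈sumFin : ∀ t (g : Vec Bool t → Carrier) →
    sumCube t g ≈ sumFin F (pow2 t) (g ∘ enumCube t)
  sumCube≈sumFin zero    g = sym (+-identityʳ _)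
  sumCube≈sumFin (suc t) g = begin
    sumCube t (g ∘ (false ∷_)) + sumCube t (g ∘ (true ∷_))
      ≈⟨ +-cong (sumCube≈sumFin t _) (sumCube≈sumFin t _) ⟩
    sumFin F (pow2 t) (λ i → g (false ∷ enumCube t i)) + sumFin F (pow2 t) (λ i → g (true ∷ enumCube t i))
      ≈⟨ +-cong (sumFin-cong (pow2 t) (λ i → reflexive (≡.cong g (enumCube-↑ˡ t i))))
                (sumFin-cong (pow2 t) (λ i → reflexive (≡.cong g (enumCube-↑ʳ t i)))) ⟨
    sumFin F (pow2 t) (λ i → g (enumCube (suc t) (i ↑ˡ pow2 t)))
      + sumFin F (pow2 t) (λ i → g (enumCube (suc t) (pow2 t ↑ʳ i)))
      ≈⟨ sumFin-++ (pow2 t) (pow2 t) _ ⟨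
    sumFin F (pow2 (suc t)) (g ∘ enumCube (suc t)) ∎

module MeetMatrix (F : Field) where
  open Field F hiding (zero)
  open IntegerCoefficientSolver commutativeRing
  open FieldProperties F
  open CubeSums F
  open import Relation.Binary.Reasoning.Setoid setoid

  möbius : ∀ t → (Vec Bool t → Carrier) → Vec Bool t → Carrier
  möbius zero    k []          = k []
  möbius (suc t) k (false ∷ T) = möbius t (k ∘ (false ∷_)) T
  möbius (suc t) k (true  ∷ T) = möbius t (λ U → k (true ∷ U) - k (false ∷ U)) T

  möbius-cong : ∀ t {k k′ : Vec Bool t → Carrier} → (∀ U → k U ≈ k′ U) →
    ∀ T → möbius t k T ≈ möbius t k′ T
  möbius-cong zero    k≈k′ []          = k≈k′ []
  möbius-cong (suc t) k≈k′ (false ∷ T) = möbius-cong t (k≈k′ ∘ (false ∷_)) T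
  möbius-cong (suc t) k≈k′ (true  ∷ T) =
    möbius-cong t (λ U → +-cong (k≈k′ (true ∷ U)) (-‿cong (k≈k′ (false ∷ U)))) T

  möbius-sub : ∀ t (k k′ : Vec Bool t → Carrier) T →
    möbius t (λ U → k U - k′ U) T ≈ möbius t k T - möbius t k′ T
  möbius-sub zero    k k′ []          = refl
  möbius-sub (suc t) k k′ (false ∷ T) = möbius-sub t _ _ T
  möbius-sub (suc t) k k′ (true  ∷ T) = trans
    (möbius-cong t (λ U → solve 4 (λ a b c d → (a :- b) :- (c :- d) := (a :- c) :- (b :- d)) refl _ _ _ _) T)
    (möbius-sub t (λ U → k (true ∷ U) - k (false ∷ U)) (λ U → k′ (true ∷ U) - k′ (false ∷ U)) T)

  -- (-1)^|T ∖ U| if U ⊆ T, and 0 otherwise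
  möbiusSign : ∀ {t} → Vec Bool t → Vec Bool t → Carrier
  möbiusSign []          []          = 1#
  möbiusSign (false ∷ T) (false ∷ U) = möbiusSign T U
  möbiusSign (false ∷ T) (true  ∷ U) = 0#
  möbiusSign (true  ∷ T) (true  ∷ U) = möbiusSign T U
  möbiusSign (true  ∷ T) (false ∷ U) = - möbiusSign T U

  möbius-signedSum : ∀ t (k : Vec Bool t → Carrier) T →
    möbius t k T ≈ sumCube t (λ U → möbiusSign T U * k U)
  möbius-signedSum zero    k []          = sym (*-identityˡ _)
  möbius-signedSum (suc t) k (false ∷ T) = begin
    möbius t (k ∘ (false ∷_)) T
      ≈⟨ möbius-signedSum t _ T ⟩
    sumCube t (λ U → möbiusSign T U * k (false ∷ U))
      ≈⟨ +-identityʳ _ ⟨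
    sumCube t (λ U → möbiusSign T U * k (false ∷ U)) + 0#
      ≈⟨ +-congˡ (trans (sumCube-cong t (λ U → zeroˡ _)) (sumCube-zero t)) ⟨
    sumCube t (λ U → möbiusSign T U * k (false ∷ U)) + sumCube t (λ U → 0# * k (true ∷ U)) ∎
  möbius-signedSum (suc t) k (true ∷ T) = begin
    möbius t (λ U → k (true ∷ U) - k (false ∷ U)) T
      ≈⟨ möbius-signedSum t _ T ⟩
    sumCube t (λ U → möbiusSign T U * (k (true ∷ U) - k (false ∷ U)))
      ≈⟨ sumCube-cong t (λ U → solve 3 (λ s a b → s :* (a :- b) := s :* a :+ :- s :* b) refl _ _ _) ⟩
    sumCube t (λ U → möbiusSign T U * k (true ∷ U) + - möbiusSign T U * k (false ∷ U))
      ≈⟨ sumCube-+ t _ _ ⟩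
    sumCube t (λ U → möbiusSign T U * k (true ∷ U)) + sumCube t (λ U → - möbiusSign T U * k (false ∷ U))
      ≈⟨ +-comm _ _ ⟩
    sumCube t (λ U → - möbiusSign T U * k (false ∷ U)) + sumCube t (λ U → möbiusSign T U * k (true ∷ U)) ∎

  -- Splitting off the first coordinate, c(1∷·) solves the system of k(1∷·) − k(0∷·) and
  -- c(0∷·) + c(1∷·) that of k(0∷·); their Möbius coefficients are those of k at 1∷T and 0∷T.
  meetSystem-trivial : ∀ t (k : Vec Bool t → Carrier) → (∀ T → möbius t k T ≉ 0#) →
    (c : Vec Bool t → Carrier) → (∀ b → sumCube t (λ a → c a * k (zipWith _∧_ a b)) ≈ 0#) →
    ∀ a → c a ≈ 0#
  meetSystem-trivial zero k möbius≉0 c system [] = x*y≈0⇒x≈0 (c []) (k []) (möbius≉0 []) (system [])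
  meetSystem-trivial (suc t) k möbius≉0 c system = c≈0
    where
    k₀ k₁ c₀ c₁ : Vec Bool t → Carrier
    k₀ = k ∘ (false ∷_)
    k₁ = k ∘ (true ∷_)
    c₀ = c ∘ (false ∷_)
    c₁ = c ∘ (true ∷_)

    system₁ : ∀ b → sumCube t (λ a → c₁ a * (k₁ (zipWith _∧_ a b) - k₀ (zipWith _∧_ a b))) ≈ 0#
    system₁ b = begin
      sumCube t (λ a → c₁ a * (k₁ (zipWith _∧_ a b) - k₀ (zipWith _∧_ a b)))
        ≈⟨ sumCube-cong t (λ a → solve 3 (λ x y z → x :* (y :- z) := x :* y :- x :* z) refl _ _ _) ⟩
      sumCube t (λ a → c₁ a * k₁ (zipWith _∧_ a b) - c₁ a * k₀ (zipWith _∧_ a b))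
        ≈⟨ sumCube-sub t _ _ ⟩
      Z - Y
        ≈⟨ solve 3 (λ X Y Z → Z :- Y := (X :+ Z) :- (X :+ Y)) refl X Y Z ⟩
      (X + Z) - (X + Y)
        ≈⟨ +-cong (system (true ∷ b)) (-‿cong (system (false ∷ b))) ⟩
      0# - 0#
        ≈⟨ -‿inverseʳ 0# ⟩
      0# ∎
      where
      X Y Z : Carrier
      X = sumCube t (λ a → c₀ a * k₀ (zipWith _∧_ a b))
      Y = sumCube t (λ a → c₁ a * k₀ (zipWith _∧_ a b))
      Z = sumCube t (λ a → c₁ a * k₁ (zipWith _∧_ a b))

    c₁≈0 : ∀ a → c₁ a ≈ 0#
    c₁≈0 = meetSystem-trivial t (λ U → k₁ U - k₀ U) (möbius≉0 ∘ (true ∷_)) c₁ system₁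

    system₀ : ∀ b → sumCube t (λ a → (c₀ a + c₁ a) * k₀ (zipWith _∧_ a b)) ≈ 0#
    system₀ b = trans (sumCube-cong t (λ a → distribʳ _ _ _)) (trans (sumCube-+ t _ _) (system (false ∷ b)))

    c₀+c₁≈0 : ∀ a → c₀ a + c₁ a ≈ 0#
    c₀+c₁≈0 = meetSystem-trivial t k₀ (möbius≉0 ∘ (false ∷_)) (λ a → c₀ a + c₁ a) system₀

    c≈0 : ∀ a → c a ≈ 0#
    c≈0 (true  ∷ a) = c₁≈0 a
    c≈0 (false ∷ a) = trans (sym (+-identityʳ _)) (trans (+-congˡ (sym (c₁≈0 a))) (c₀+c₁≈0 a))

  meetMatrix-rowsIndependent : ∀ t (k : Vec Bool t → Carrier) → (∀ T → möbius t k T ≉ 0#) →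
    RowsIndependent (λ i w → k (zipWith _∧_ (enumCube t i) w))
  meetMatrix-rowsIndependent t k möbius≉0 c system i = begin
    c i
      ≡⟨ ≡.cong c (index-enumCube t i) ⟨
    c (indexCube t (enumCube t i))
      ≈⟨ meetSystem-trivial t k möbius≉0 (c ∘ indexCube t) cubeSystem (enumCube t i) ⟩
    0# ∎
    where
    cubeSystem : ∀ w → sumCube t (λ a → c (indexCube t a) * k (zipWith _∧_ a w)) ≈ 0#
    cubeSystem w = trans (sumCube≈sumFin t _)
      (trans (sumFin-cong (pow2 t) (λ i → *-congʳ (reflexive (≡.cong c (index-enumCube t i))))) (system w))

module LinearAlgebra (F : Field) (_≟_ : ∀ x y → Dec (Field._≈_ F x y)) where
  open Field F hiding (zero)
  open IntegerCoefficientSolver commutativeRing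
  open FieldProperties F
  open import Relation.Binary.Reasoning.Setoid setoid

  RowDependence : ∀ m w → (Fin m → Fin w → Carrier) → Set
  RowDependence m w u = ∃ λ (c : Fin m → Carrier) →
    (∃ λ i → c i ≉ 0#) × (∀ j → sumFin F m (λ i → c i * u i j) ≈ 0#)

  zeroRow-dependence : ∀ m w (u : Fin (suc m) → Fin w → Carrier) →
    (∀ j → u zero j ≈ 0#) → RowDependence (suc m) w u
  zeroRow-dependence m w u u₀≈0 = c , (zero , 1≉0) , relation
    where
    c : Fin (suc m) → Carrier
    c zero    = 1#
    c (suc i) = 0#
    1≉0 : 1# ≉ 0#
    1≉0 1≈0 = 0≉1 (sym 1≈0)
    relation : ∀ j → sumFin F (suc m) (λ i → c i * u i j) ≈ 0#
    relation j = trans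
      (+-cong (trans (*-congˡ (u₀≈0 j)) (zeroʳ _)) (sumFin-zero m (λ i → zeroˡ _)))
      (+-identityˡ _)

  linearDependence : ∀ m w → w < m → (u : Fin m → Fin w → Carrier) → RowDependence m w u

  clearColumn : ∀ {m w} → (Fin (suc m) → Fin w → Carrier) → Fin w → Fin m → Fin w → Carrier
  clearColumn u j₀ i j = u (suc i) j - (u (suc i) j₀ * u zero j₀ ⁻¹) * u zero j

  clearColumn-pivot : ∀ {m w} (u : Fin (suc m) → Fin w → Carrier) j₀ → u zero j₀ ≉ 0# →
    ∀ i → clearColumn u j₀ i j₀ ≈ 0#
  clearColumn-pivot u j₀ pivot i = trans (+-congˡ (-‿cong (begin
    (u (suc i) j₀ * u zero j₀ ⁻¹) * u zero j₀ ≈⟨ *-assoc _ _ _ ⟩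
    u (suc i) j₀ * (u zero j₀ ⁻¹ * u zero j₀) ≈⟨ *-congˡ (⁻¹-inverseˡ _ pivot) ⟩
    u (suc i) j₀ * 1#                         ≈⟨ *-identityʳ _ ⟩
    u (suc i) j₀                              ∎))) (-‿inverseʳ _)

  -- Rows 1 … m with the pivot column cleared have only w − 1 relevant columns, so they
  -- are dependent by induction; the coefficient of row 0 compensates for the multiples
  -- of it that were subtracted.
  pivot-dependence : ∀ m w → w < suc m → (u : Fin (suc m) → Fin w → Carrier) →
    (j₀ : Fin w) → u zero j₀ ≉ 0# → RowDependence (suc m) w u
  pivot-dependence m (suc w) (s≤s w<m) u j₀ pivot
    with linearDependence m w w<m (λ i j → clearColumn u j₀ i (punchIn j₀ j))
  ... | c′ , (i₁ , c′ᵢ₁≉0) , c′-relation = c , (suc i₁ , c′ᵢ₁≉0) , relation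
    where
    factor : Fin m → Carrier
    factor i = u (suc i) j₀ * u zero j₀ ⁻¹

    cleared-relation : ∀ j → sumFin F m (λ i → c′ i * clearColumn u j₀ i j) ≈ 0#
    cleared-relation j with j₀ Fin.≟ j
    ... | yes ≡.refl = sumFin-zero m (λ i → trans (*-congˡ (clearColumn-pivot u j₀ pivot i)) (zeroʳ _))
    ... | no j₀≢j = begin
      sumFin F m (λ i → c′ i * clearColumn u j₀ i j)
        ≡⟨ ≡.cong (λ j′ → sumFin F m (λ i → c′ i * clearColumn u j₀ i j′))
                  (FinP.punchIn-punchOut j₀≢j) ⟨
      sumFin F m (λ i → c′ i * clearColumn u j₀ i (punchIn j₀ (punchOut j₀≢j)))
        ≈⟨ c′-relation _ ⟩
      0# ∎

    Λ : Carrier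
    Λ = sumFin F m (λ i → c′ i * factor i)

    c : Fin (suc m) → Carrier
    c zero    = - Λ
    c (suc i) = c′ i

    relation : ∀ j → sumFin F (suc m) (λ i → c i * u i j) ≈ 0#
    relation j = begin
      - Λ * u zero j + sumFin F m (λ i → c′ i * u (suc i) j)
        ≈⟨ +-congˡ (x-y≈0⇒x≈y _ _ (trans (sym (sumFin-sub m _ _))
             (trans (sumFin-cong m (λ i →
                      solve 4 (λ c y l z → c :* y :- (c :* l) :* z := c :* (y :- l :* z)) refl _ _ _ _))
                    (cleared-relation j)))) ⟩
      - Λ * u zero j + sumFin F m (λ i → (c′ i * factor i) * u zero j)
        ≈⟨ +-congˡ (*-distribʳ-sumFin m _ _) ⟩
      - Λ * u zero j + Λ * u zero j
        ≈⟨ solve 2 (λ L x → :- L :* x :+ L :* x := con (ℤ.+ 0)) refl Λ (u zero j) ⟩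
      0# ∎

  linearDependence (suc m) w w<m u with FinP.any? (λ j → ¬? (u zero j ≟ 0#))
  ... | yes (j₀ , pivot) = pivot-dependence m w w<m u j₀ pivot
  ... | no  noPivot      = zeroRow-dependence m w u
          (λ j → decidable-stable (u zero j ≟ 0#) (λ u≉0 → noPivot (j , u≉0)))

  rowsIndependent⇒≤ : ∀ {N b} {W : Set} (M : Fin N → W → Carrier)
    (P : Fin b → Fin N → Carrier) (Q : Fin b → W → Carrier) →
    (∀ i w → M i w ≈ sumFin F b (λ v → P v i * Q v w)) → RowsIndependent M → N ≤ b
  rowsIndependent⇒≤ {N} {b} M P Q M≈PQ independent = ℕP.≮⇒≥ b≮N
    where
    b≮N : ¬ b < N
    b≮N b<N with linearDependence N b b<N (λ i v → P v i)
    ... | c , (i , cᵢ≉0) , cP≈0 = cᵢ≉0 (independent c cM≈0 i)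
      where
      cM≈0 : ∀ w → sumFin F N (λ i → c i * M i w) ≈ 0#
      cM≈0 w = begin
        sumFin F N (λ i → c i * M i w)
          ≈⟨ sumFin-cong N (λ i → trans (*-congˡ (M≈PQ i w)) (sym (*-distribˡ-sumFin b _ _))) ⟩
        sumFin F N (λ i → sumFin F b (λ v → c i * (P v i * Q v w)))
          ≈⟨ sumFin-swap N b _ ⟩
        sumFin F b (λ v → sumFin F N (λ i → c i * (P v i * Q v w)))
          ≈⟨ sumFin-cong b (λ v →
               trans (sumFin-cong N (λ i → sym (*-assoc _ _ _))) (*-distribʳ-sumFin N _ _)) ⟩
        sumFin F b (λ v → sumFin F N (λ i → c i * P v i) * Q v w)
          ≈⟨ sumFin-zero b (λ v → trans (*-congʳ (cP≈0 v)) (zeroˡ _)) ⟩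
        0# ∎

module UnivariatePolynomials (F : Field) where
  open Field F hiding (zero)
  open IntegerCoefficientSolver commutativeRing
  open import Relation.Binary.Reasoning.Setoid setoid

  ueval : UPoly F → Carrier → Carrier
  ueval []      x = 0#
  ueval (a ∷ P) x = a + x * ueval P x

  uadd : UPoly F → UPoly F → UPoly F
  uadd []      Q       = Q
  uadd (a ∷ P) []      = a ∷ P
  uadd (a ∷ P) (b ∷ Q) = (a + b) ∷ uadd P Q

  uscale : Carrier → UPoly F → UPoly F
  uscale c []      = []
  uscale c (a ∷ P) = (c * a) ∷ uscale c P

  umul : UPoly F → UPoly F → UPoly F
  umul []      Q = []
  umul (a ∷ P) Q = uadd (uscale a Q) (0# ∷ umul P Q)

  ueval-cong : ∀ P {x y} → x ≈ y → ueval P x ≈ ueval P y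
  ueval-cong []      x≈y = refl
  ueval-cong (a ∷ P) x≈y = +-congˡ (*-cong x≈y (ueval-cong P x≈y))

  ueval-+ : ∀ P Q x → ueval (uadd P Q) x ≈ ueval P x + ueval Q x
  ueval-+ []      Q       x = sym (+-identityˡ _)
  ueval-+ (a ∷ P) []      x = sym (+-identityʳ _)
  ueval-+ (a ∷ P) (b ∷ Q) x = trans (+-congˡ (*-congˡ (ueval-+ P Q x)))
    (solve 5 (λ a b x p q → (a :+ b) :+ x :* (p :+ q) := (a :+ x :* p) :+ (b :+ x :* q)) refl a b x _ _)

  ueval-scale : ∀ c P x → ueval (uscale c P) x ≈ c * ueval P x
  ueval-scale c []      x = sym (zeroʳ c)
  ueval-scale c (a ∷ P) x = trans (+-congˡ (*-congˡ (ueval-scale c P x)))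
    (solve 4 (λ c a x p → c :* a :+ x :* (c :* p) := c :* (a :+ x :* p)) refl c a x _)

  ueval-* : ∀ P Q x → ueval (umul P Q) x ≈ ueval P x * ueval Q x
  ueval-* []      Q x = sym (zeroˡ _)
  ueval-* (a ∷ P) Q x = begin
    ueval (uadd (uscale a Q) (0# ∷ umul P Q)) x
      ≈⟨ ueval-+ (uscale a Q) (0# ∷ umul P Q) x ⟩
    ueval (uscale a Q) x + (0# + x * ueval (umul P Q) x)
      ≈⟨ +-cong (ueval-scale a Q x) (+-congˡ (*-congˡ (ueval-* P Q x))) ⟩
    a * ueval Q x + (0# + x * (ueval P x * ueval Q x))
      ≈⟨ solve 4 (λ a q x p → a :* q :+ (con (ℤ.+ 0) :+ x :* (p :* q)) := (a :+ x :* p) :* q) refl _ _ _ _ ⟩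
    (a + x * ueval P x) * ueval Q x ∎

  ucoeff-+ : ∀ P Q i → ucoeff F (uadd P Q) i ≈ ucoeff F P i + ucoeff F Q i
  ucoeff-+ []      Q       i       = sym (+-identityˡ _)
  ucoeff-+ (a ∷ P) []      zero    = sym (+-identityʳ _)
  ucoeff-+ (a ∷ P) []      (suc i) = sym (+-identityʳ _)
  ucoeff-+ (a ∷ P) (b ∷ Q) zero    = refl
  ucoeff-+ (a ∷ P) (b ∷ Q) (suc i) = ucoeff-+ P Q i

  ucoeff-scale : ∀ c P i → ucoeff F (uscale c P) i ≈ c * ucoeff F P i
  ucoeff-scale c []      i       = sym (zeroʳ c)
  ucoeff-scale c (a ∷ P) zero    = refl
  ucoeff-scale c (a ∷ P) (suc i) = ucoeff-scale c P i

  ucoeff-*-zero : ∀ a P Q → ucoeff F (umul (a ∷ P) Q) zero ≈ a * ucoeff F Q zero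
  ucoeff-*-zero a P Q = trans (ucoeff-+ (uscale a Q) _ zero) (trans (+-congʳ (ucoeff-scale a Q zero)) (+-identityʳ _))

  ucoeff-*-suc : ∀ a P Q i →
    ucoeff F (umul (a ∷ P) Q) (suc i) ≈ a * ucoeff F Q (suc i) + ucoeff F (umul P Q) i
  ucoeff-*-suc a P Q i = trans (ucoeff-+ (uscale a Q) _ (suc i)) (+-congʳ (ucoeff-scale a Q (suc i)))

  IsZeroPoly : UPoly F → Set
  IsZeroPoly P = ∀ i → ucoeff F P i ≈ 0#

  DegreeAtMost : ℕ → UPoly F → Set
  DegreeAtMost d P = ∀ i → d < i → ucoeff F P i ≈ 0#

  LeadingTerm : ℕ → Carrier → UPoly F → Set
  LeadingTerm d c P = (ucoeff F P d ≈ c) × DegreeAtMost d P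

  isZero-* : ∀ P Q → IsZeroPoly P → IsZeroPoly (umul P Q)
  isZero-* []      Q P≈0 i       = refl
  isZero-* (a ∷ P) Q P≈0 zero    = trans (ucoeff-*-zero a P Q) (trans (*-congʳ (P≈0 zero)) (zeroˡ _))
  isZero-* (a ∷ P) Q P≈0 (suc i) = trans (ucoeff-*-suc a P Q i)
    (trans (+-cong (trans (*-congʳ (P≈0 zero)) (zeroˡ _)) (isZero-* P Q (P≈0 ∘ suc) i)) (+-identityˡ _))

  ucoeff-*-shift : ∀ a P Q i → ucoeff F Q (suc i) ≈ 0# →
    ucoeff F (umul (a ∷ P) Q) (suc i) ≈ ucoeff F (umul P Q) i
  ucoeff-*-shift a P Q i Qᵢ₊₁≈0 =
    trans (ucoeff-*-suc a P Q i) (trans (+-congʳ (trans (*-congˡ Qᵢ₊₁≈0) (zeroʳ a))) (+-identityˡ _))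

  degree-* : ∀ d₁ d₂ P Q → DegreeAtMost d₁ P → DegreeAtMost d₂ Q → DegreeAtMost (d₁ ℕ.+ d₂) (umul P Q)
  degree-* d₁       d₂ []      Q P≤d₁ Q≤d₂ i       _         = refl
  degree-* zero     d₂ (a ∷ P) Q P≤0  Q≤d₂ (suc i) d₂<i+1 =
    trans (ucoeff-*-shift a P Q i (Q≤d₂ (suc i) d₂<i+1)) (isZero-* P Q (λ j → P≤0 (suc j) (s≤s z≤n)) i)
  degree-* (suc d₁) d₂ (a ∷ P) Q P≤d₁ Q≤d₂ (suc i) (s≤s d₁+d₂<i) =
    trans (ucoeff-*-shift a P Q i
            (Q≤d₂ (suc i) (s≤s (ℕP.≤-trans (ℕP.m≤n+m d₂ d₁) (ℕP.<⇒≤ d₁+d₂<i)))))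
          (degree-* d₁ d₂ P Q (λ j d₁<j → P≤d₁ (suc j) (s≤s d₁<j)) Q≤d₂ i d₁+d₂<i)

  ucoeff-*-top : ∀ d₁ d₂ P Q → DegreeAtMost d₁ P → DegreeAtMost d₂ Q →
    ucoeff F (umul P Q) (d₁ ℕ.+ d₂) ≈ ucoeff F P d₁ * ucoeff F Q d₂
  ucoeff-*-top d₁       d₂       []      Q P≤d₁ Q≤d₂ = sym (zeroˡ _)
  ucoeff-*-top zero     zero     (a ∷ P) Q P≤0  Q≤d₂ = ucoeff-*-zero a P Q
  ucoeff-*-top zero     (suc d₂) (a ∷ P) Q P≤0  Q≤d₂ = trans (ucoeff-*-suc a P Q d₂)
    (trans (+-congˡ (isZero-* P Q (λ j → P≤0 (suc j) (s≤s z≤n)) d₂)) (+-identityʳ _))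
  ucoeff-*-top (suc d₁) d₂       (a ∷ P) Q P≤d₁ Q≤d₂ =
    trans (ucoeff-*-shift a P Q (d₁ ℕ.+ d₂) (Q≤d₂ _ (s≤s (ℕP.m≤n+m d₂ d₁))))
          (ucoeff-*-top d₁ d₂ P Q (λ j d₁<j → P≤d₁ (suc j) (s≤s d₁<j)) Q≤d₂)

  leadingTerm-* : ∀ d₁ d₂ c₁ c₂ P Q → LeadingTerm d₁ c₁ P → LeadingTerm d₂ c₂ Q →
    LeadingTerm (d₁ ℕ.+ d₂) (c₁ * c₂) (umul P Q)
  leadingTerm-* d₁ d₂ c₁ c₂ P Q (P₁≈c₁ , P≤d₁) (Q₂≈c₂ , Q≤d₂) =
    trans (ucoeff-*-top d₁ d₂ P Q P≤d₁ Q≤d₂) (*-cong P₁≈c₁ Q₂≈c₂) ,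
    degree-* d₁ d₂ P Q P≤d₁ Q≤d₂

  DegreeBelow : ℕ → UPoly F → Set
  DegreeBelow d P = ∀ i → d ≤ i → ucoeff F P i ≈ 0#

  degreeBelow-* : ∀ d₁ d₂ P Q → DegreeBelow d₁ P → DegreeAtMost d₂ Q →
    DegreeBelow (d₁ ℕ.+ d₂) (umul P Q)
  degreeBelow-* zero     d₂ P Q P<0 Q≤d₂ i _ = isZero-* P Q (λ j → P<0 j z≤n) i
  degreeBelow-* (suc d₁) d₂ P Q P<d₁ Q≤d₂    = degree-* d₁ d₂ P Q P<d₁ Q≤d₂

  degreeBelow-+ : ∀ d P Q → DegreeBelow d P → DegreeBelow d Q → DegreeBelow d (uadd P Q)
  degreeBelow-+ d P Q P<d Q<d i d≤i =
    trans (ucoeff-+ P Q i) (trans (+-cong (P<d i d≤i) (Q<d i d≤i)) (+-identityˡ _))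

  -- synthetic division by x − r
  divLinear : Carrier → UPoly F → UPoly F × Carrier
  divLinear r []      = [] , 0#
  divLinear r (a ∷ P) = let (Q , ρ) = divLinear r P in (ρ ∷ Q) , a + r * ρ

  quotLinear : Carrier → UPoly F → UPoly F
  quotLinear r P = proj₁ (divLinear r P)

  remLinear : Carrier → UPoly F → Carrier
  remLinear r P = proj₂ (divLinear r P)

  divLinear-ueval : ∀ r P x → ueval P x ≈ (x - r) * ueval (quotLinear r P) x + remLinear r P
  divLinear-ueval r []      x = solve 2 (λ x r → con (ℤ.+ 0) := (x :- r) :* con (ℤ.+ 0) :+ con (ℤ.+ 0)) refl x r
  divLinear-ueval r (a ∷ P) x = trans (+-congˡ (*-congˡ (divLinear-ueval r P x)))
    (solve 5 (λ a x r q m → a :+ x :* ((x :- r) :* q :+ m) := (x :- r) :* (m :+ x :* q) :+ (a :+ r :* m))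
      refl a x r _ _)

  ueval-isZero : ∀ P x → IsZeroPoly P → ueval P x ≈ 0#
  ueval-isZero []      x P≈0 = refl
  ueval-isZero (a ∷ P) x P≈0 =
    trans (+-cong (P≈0 zero) (trans (*-congˡ (ueval-isZero P x (P≈0 ∘ suc))) (zeroʳ _))) (+-identityˡ _)

  ueval-degree0 : ∀ P x → DegreeAtMost 0 P → ueval P x ≈ ucoeff F P 0
  ueval-degree0 []      x P≤0 = refl
  ueval-degree0 (a ∷ P) x P≤0 =
    trans (+-congˡ (trans (*-congˡ (ueval-isZero P x (λ i → P≤0 (suc i) (s≤s z≤n)))) (zeroʳ _)))
          (+-identityʳ _)

  divLinear-degree0 : ∀ r P → DegreeAtMost 0 P → IsZeroPoly (quotLinear r P) × remLinear r P ≈ ucoeff F P 0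
  divLinear-degree0 r []      P≤0 = (λ i → refl) , refl
  divLinear-degree0 r (a ∷ P) P≤0 =
    quotient≈0 , trans (+-congˡ (trans (*-congˡ remainder≈0) (zeroʳ _))) (+-identityʳ _)
    where
    P≈0 : IsZeroPoly P
    P≈0 i = P≤0 (suc i) (s≤s z≤n)
    remainder≈0 : remLinear r P ≈ 0#
    remainder≈0 = trans (proj₂ (divLinear-degree0 r P (λ i _ → P≈0 i))) (P≈0 0)
    quotient≈0 : IsZeroPoly (remLinear r P ∷ quotLinear r P)
    quotient≈0 zero    = remainder≈0
    quotient≈0 (suc i) = proj₁ (divLinear-degree0 r P (λ i _ → P≈0 i)) i

  divLinear-leadingTerm : ∀ r d P → DegreeAtMost (suc d) P → LeadingTerm d (ucoeff F P (suc d)) (quotLinear r P)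
  divLinear-leadingTerm r d       []      P≤d+1 = refl , λ i _ → refl
  divLinear-leadingTerm r zero    (a ∷ P) P≤1   = proj₂ (divLinear-degree0 r P P≤0) , quotient≤0
    where
    P≤0 : DegreeAtMost 0 P
    P≤0 i 0<i = P≤1 (suc i) (s≤s 0<i)
    quotient≤0 : DegreeAtMost 0 (remLinear r P ∷ quotLinear r P)
    quotient≤0 (suc i) _ = proj₁ (divLinear-degree0 r P P≤0) i
  divLinear-leadingTerm r (suc d) (a ∷ P) P≤d+2 = proj₁ quotient-leading , quotient≤d+1
    where
    quotient-leading : LeadingTerm d (ucoeff F P (suc d)) (quotLinear r P)
    quotient-leading = divLinear-leadingTerm r d P (λ i d+1<i → P≤d+2 (suc i) (s≤s d+1<i))
    quotient≤d+1 : DegreeAtMost (suc d) (remLinear r P ∷ quotLinear r P)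
    quotient≤d+1 (suc i) (s≤s d<i) = proj₂ quotient-leading i d<i

module PolynomialRoots (F : Field) (_≟_ : ∀ x y → Dec (Field._≈_ F x y))
  {N : ℕ} (e : Fin N → Field.Carrier F) (e-surjective : ∀ x → ∃ λ i → Field._≈_ F (e i) x) where
  open Field F hiding (zero)
  open FieldProperties F
  open UnivariatePolynomials F
  open import Relation.Binary.Reasoning.Setoid setoid

  roots-bounded : ∀ d c P → LeadingTerm d c P → c ≉ 0# →
    ∃ λ (rs : Fin d → Carrier) → ∀ x → ueval P x ≈ 0# → ∃ λ j → x ≈ rs j
  roots-bounded zero c P (P₀≈c , degree≤0) c≉0 = (λ ()) , λ x Px≈0 →
    ⊥-elim (c≉0 (trans (sym P₀≈c) (trans (sym (ueval-degree0 P x degree≤0)) Px≈0)))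
  roots-bounded (suc d) c P (Pₛ≈c , degree≤d+1) c≉0 with FinP.any? (λ i → ueval P (e i) ≟ 0#)
  ... | no noRoot = (λ _ → 0#) , λ x Px≈0 →
    ⊥-elim (noRoot (proj₁ (e-surjective x) , trans (ueval-cong P (proj₂ (e-surjective x))) Px≈0))
  ... | yes (i , Pr≈0) = rs , covered
    where
    r : Carrier
    r = e i
    quotient-roots : ∃ λ (rs : Fin d → Carrier) →
      ∀ x → ueval (quotLinear r P) x ≈ 0# → ∃ λ j → x ≈ rs j
    quotient-roots = let (quotientᵈ≈ , quotient≤d) = divLinear-leadingTerm r d P degree≤d+1 in
      roots-bounded d c (quotLinear r P) (trans quotientᵈ≈ Pₛ≈c , quotient≤d) c≉0
    rs : Fin (suc d) → Carrier
    rs zero    = r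
    rs (suc j) = proj₁ quotient-roots j
    remainder≈0 : remLinear r P ≈ 0#
    remainder≈0 = begin
      remLinear r P                                      ≈⟨ +-identityˡ _ ⟨
      0# + remLinear r P                                 ≈⟨ +-congʳ (trans (*-congʳ (-‿inverseʳ r)) (zeroˡ _)) ⟨
      (r - r) * ueval (quotLinear r P) r + remLinear r P ≈⟨ divLinear-ueval r P r ⟨
      ueval P r                                          ≈⟨ Pr≈0 ⟩
      0#                                                 ∎
    covered : ∀ x → ueval P x ≈ 0# → ∃ λ j → x ≈ rs j
    covered x Px≈0 with (x - r) ≟ 0#
    ... | yes x-r≈0 = zero , x-y≈0⇒x≈y x r x-r≈0
    ... | no  x-r≉0 =
      let (j , x≈rⱼ) = proj₂ quotient-roots x (x*y≈0⇒y≈0 _ _ x-r≉0 product≈0) in suc j , x≈rⱼ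
      where
      product≈0 : (x - r) * ueval (quotLinear r P) x ≈ 0#
      product≈0 = trans (sym (+-identityʳ _))
        (trans (+-congˡ (sym remainder≈0)) (trans (sym (divLinear-ueval r P x)) Px≈0))

module Avoidance (F : Field) (_≟_ : ∀ x y → Dec (Field._≈_ F x y)) where
  open Field F hiding (zero)

  avoid : ∀ {K m n} (s : Fin K → Carrier) → (∀ i i′ → s i ≈ s i′ → i ≡ i′) → m ℕ.* n < K →
    (r : Fin m → Fin n → Carrier) → ∃ λ i → ∀ a b → s i ≉ r a b
  avoid {K} {m} {n} s s-injective mn<K r
    with FinP.any? (λ i → FinP.all? (λ a → FinP.all? (λ b → ¬? (s i ≟ r a b))))
  ... | yes found = found
  ... | no  none  = contradiction (FinP.injective⇒≤ hit-injective) (ℕP.<⇒≱ mn<K)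
    where
    hit : ∀ i → ∃ λ a → ∃ λ b → s i ≈ r a b
    hit i with FinP.any? (λ a → FinP.any? (λ b → s i ≟ r a b))
    ... | yes found = found
    ... | no  miss  = ⊥-elim (none (i , λ a b sᵢ≈r → miss (a , b , sᵢ≈r)))
    hitIndex : Fin K → Fin (m ℕ.* n)
    hitIndex i = let (a , b , _) = hit i in Fin.combine a b
    hit-injective : ∀ {i i′} → hitIndex i ≡ hitIndex i′ → i ≡ i′
    hit-injective {i} {i′} eq with hit i | hit i′
    ... | a , b , sᵢ≈r | a′ , b′ , sᵢ′≈r′ with FinP.combine-injective a b a′ b′ eq
    ... | ≡.refl , ≡.refl = s-injective i i′ (trans sᵢ≈r (sym sᵢ′≈r′))

module InverseForms (F : Field) where
  open Field F hiding (zero)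
  open IntegerCoefficientSolver commutativeRing

  subsetSum : ∀ {t} → Vec Carrier t → Vec Bool t → Carrier
  subsetSum []      []      = 0#
  subsetSum (a ∷ α) (s ∷ U) = bit F s * a + subsetSum α U

  inverseForm : ∀ {t} → Vec Carrier t → Carrier → Vec Bool t → Carrier
  inverseForm α γ U = (subsetSum α U - γ) ⁻¹

  subsetSum-meet : ∀ {t} (α : Vec Carrier t) u w →
    sumFin F t (λ i → (lookup α i * bit F (lookup u i)) * bit F (lookup w i)) ≈ subsetSum α (zipWith _∧_ u w)
  subsetSum-meet []      []      []      = refl
  subsetSum-meet (a ∷ α) (x ∷ u) (y ∷ w) = +-cong (bit-∧ x y) (subsetSum-meet α u w)
    where
    bit-∧ : ∀ x y → (a * bit F x) * bit F y ≈ bit F (x ∧ y) * a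
    bit-∧ true  y = solve 2 (λ a b → (a :* con (ℤ.+ 1)) :* b := b :* a) refl a (bit F y)
    bit-∧ false y = solve 2 (λ a b → (a :* con (ℤ.+ 0)) :* b := con (ℤ.+ 0) :* a) refl a (bit F y)

module CoefficientChoice (F : Field) (_≟_ : ∀ x y → Dec (Field._≈_ F x y))
  {N : ℕ} (e : Fin N → Field.Carrier F) (e-surjective : ∀ x → ∃ λ i → Field._≈_ F (e i) x)
  (S : Field.Carrier F → Set) {K : ℕ} (S-subfield : IsSubfieldOfSize F S K)
  (β : Field.Carrier F) (β∉S : ¬ S β) where
  open Field F hiding (zero)
  open IntegerCoefficientSolver commutativeRing
  open FieldProperties F
  open CubeSums F
  open MeetMatrix F
  open InverseForms F
  open UnivariatePolynomials F
  open PolynomialRoots F _≟_ e e-surjective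
  open Avoidance F _≟_
  open import Algebra.Properties.Ring ring using (-‿involutive; -0#≈0#)
  module S = IsSubfieldOfSize S-subfield
  open import Relation.Binary.Reasoning.Setoid setoid

  x∈S⇒x-γ≉0 : ∀ {x γ} → S x → ¬ S γ → x - γ ≉ 0#
  x∈S⇒x-γ≉0 {x} {γ} x∈S γ∉S x-γ≈0 = γ∉S (S.resp (x-y≈0⇒x≈y x γ x-γ≈0) x∈S)

  β-x∉S : ∀ {x} → S x → ¬ S (β - x)
  β-x∉S {x} x∈S β-x∈S = β∉S (S.resp (solve 2 (λ b x → (b :- x) :+ x := b) refl β x) (S.plus β-x∈S x∈S))

  bit∈S : ∀ b → S (bit F b)
  bit∈S true  = S.has1
  bit∈S false = S.has0

  AllInS : ∀ {t} → Vec Carrier t → Set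
  AllInS α = ∀ i → S (lookup α i)

  subsetSum∈S : ∀ {t} (α : Vec Carrier t) → AllInS α → ∀ U → S (subsetSum α U)
  subsetSum∈S []      α∈S []      = S.has0
  subsetSum∈S (a ∷ α) α∈S (s ∷ U) =
    S.plus (S.times (bit∈S s) (α∈S zero)) (subsetSum∈S α (α∈S ∘ suc) U)

  record RationalOnS (d : ℕ) (f : Carrier → Carrier) : Set where
    field
      numerator denominator : UPoly F
      denominator-monic     : LeadingTerm d 1# denominator
      numerator-degree      : DegreeBelow d numerator
      denominator-nonzero   : ∀ x → S x → ueval denominator x ≉ 0#
      agrees                : ∀ x → S x → f x * ueval denominator x ≈ ueval numerator x

  rational-cong : ∀ {d f g} → (∀ x → S x → f x ≈ g x) → RationalOnS d f → RationalOnS d g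
  rational-cong f≈g r = record
    { numerator = numerator ; denominator = denominator
    ; denominator-monic = denominator-monic ; numerator-degree = numerator-degree
    ; denominator-nonzero = denominator-nonzero
    ; agrees = λ x x∈S → trans (*-congʳ (sym (f≈g x x∈S))) (agrees x x∈S) }
    where open RationalOnS r

  rational-pole : ∀ s r → ¬ S r → RationalOnS 1 (λ x → s * (x - r) ⁻¹)
  rational-pole s r r∉S = record
    { numerator = s ∷ [] ; denominator = - r ∷ 1# ∷ []
    ; denominator-monic = refl , degree≤1 ; numerator-degree = degree<1
    ; denominator-nonzero = λ x x∈S D≈0 → x∈S⇒x-γ≉0 x∈S r∉S (trans (sym (ueval-denominator x)) D≈0)
    ; agrees = agrees }
    where
    degree≤1 : DegreeAtMost 1 (- r ∷ 1# ∷ [])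
    degree≤1 (suc zero)    (s≤s ())
    degree≤1 (suc (suc i)) _ = refl
    degree<1 : DegreeBelow 1 (s ∷ [])
    degree<1 (suc i) _ = refl
    ueval-denominator : ∀ x → ueval (- r ∷ 1# ∷ []) x ≈ x - r
    ueval-denominator x = solve 2 (λ r x → :- r :+ x :* (con (ℤ.+ 1) :+ x :* con (ℤ.+ 0)) := x :- r) refl r x
    agrees : ∀ x → S x → (s * (x - r) ⁻¹) * ueval (- r ∷ 1# ∷ []) x ≈ ueval (s ∷ []) x
    agrees x x∈S = begin
      (s * (x - r) ⁻¹) * ueval (- r ∷ 1# ∷ []) x ≈⟨ *-congˡ (ueval-denominator x) ⟩
      (s * (x - r) ⁻¹) * (x - r)                ≈⟨ *-assoc _ _ _ ⟩
      s * ((x - r) ⁻¹ * (x - r))                ≈⟨ *-congˡ (⁻¹-inverseˡ _ (x∈S⇒x-γ≉0 x∈S r∉S)) ⟩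
      s * 1#
        ≈⟨ solve 2 (λ s x → s :* con (ℤ.+ 1) := s :+ x :* con (ℤ.+ 0)) refl s x ⟩
      s + x * 0#                                ∎

  rational-+ : ∀ {d₁ d₂ f g} → RationalOnS d₁ f → RationalOnS d₂ g →
    RationalOnS (d₁ ℕ.+ d₂) (λ x → f x + g x)
  rational-+ {d₁} {d₂} {f} {g} r₁ r₂ = record
    { numerator = Num ; denominator = Den
    ; denominator-monic = trans (proj₁ Den-leading) (*-identityʳ 1#) , proj₂ Den-leading
    ; numerator-degree = degreeBelow-+ (d₁ ℕ.+ d₂) (umul N₁ D₂) (umul N₂ D₁)
        (degreeBelow-* d₁ d₂ N₁ D₂ N₁<d₁ (proj₂ D₂-monic))
        (≡.subst (λ d → DegreeBelow d (umul N₂ D₁)) (ℕP.+-comm d₂ d₁)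
          (degreeBelow-* d₂ d₁ N₂ D₁ N₂<d₂ (proj₂ D₁-monic)))
    ; denominator-nonzero = λ x x∈S Den≈0 →
        *-nonzero (D₁≉0 x x∈S) (D₂≉0 x x∈S) (trans (sym (ueval-* D₁ D₂ x)) Den≈0)
    ; agrees = agrees }
    where
    open RationalOnS r₁ renaming (numerator to N₁; denominator to D₁; denominator-monic to D₁-monic;
      numerator-degree to N₁<d₁; denominator-nonzero to D₁≉0; agrees to agrees₁)
    open RationalOnS r₂ renaming (numerator to N₂; denominator to D₂; denominator-monic to D₂-monic;
      numerator-degree to N₂<d₂; denominator-nonzero to D₂≉0; agrees to agrees₂)
    Num Den : UPoly F
    Num = uadd (umul N₁ D₂) (umul N₂ D₁)
    Den = umul D₁ D₂
    Den-leading : LeadingTerm (d₁ ℕ.+ d₂) (1# * 1#) Den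
    Den-leading = leadingTerm-* d₁ d₂ 1# 1# D₁ D₂ D₁-monic D₂-monic
    agrees : ∀ x → S x → (f x + g x) * ueval Den x ≈ ueval Num x
    agrees x x∈S = begin
      (f x + g x) * ueval Den x
        ≈⟨ *-congˡ (ueval-* D₁ D₂ x) ⟩
      (f x + g x) * (ueval D₁ x * ueval D₂ x)
        ≈⟨ solve 4 (λ a b c d → (a :+ b) :* (c :* d) := (a :* c) :* d :+ (b :* d) :* c) refl _ _ _ _ ⟩
      (f x * ueval D₁ x) * ueval D₂ x + (g x * ueval D₂ x) * ueval D₁ x
        ≈⟨ +-cong (*-congʳ (agrees₁ x x∈S)) (*-congʳ (agrees₂ x x∈S)) ⟩
      ueval N₁ x * ueval D₂ x + ueval N₂ x * ueval D₁ x
        ≈⟨ +-cong (ueval-* N₁ D₂ x) (ueval-* N₂ D₁ x) ⟨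
      ueval (umul N₁ D₂) x + ueval (umul N₂ D₁) x
        ≈⟨ ueval-+ (umul N₁ D₂) (umul N₂ D₁) x ⟨
      ueval Num x ∎

  rational-sumCube : ∀ t (g : Vec Bool t → Carrier → Carrier) → (∀ U → RationalOnS 1 (g U)) →
    RationalOnS (pow2 t) (λ x → sumCube t (λ U → g U x))
  rational-sumCube zero    g g-rational = g-rational []
  rational-sumCube (suc t) g g-rational = rational-+
    (rational-sumCube t _ (g-rational ∘ (false ∷_)))
    (rational-sumCube t _ (g-rational ∘ (true ∷_)))

  -- f x ≈ C means that x is a root of numerator − C · denominator, whose leading
  -- coefficient is − C.
  rational-levelSet-bounded : ∀ {d f} → RationalOnS d f → ∀ C → C ≉ 0# →
    ∃ λ (rs : Fin d → Carrier) → ∀ x → S x → f x ≈ C → ∃ λ j → x ≈ rs j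
  rational-levelSet-bounded {d} {f} r C C≉0 =
    let (rs , covered) = roots-bounded d (- C) P P-leading -C≉0 in
    rs , λ x x∈S fx≈C → covered x (P-root x x∈S fx≈C)
    where
    open RationalOnS r
    P : UPoly F
    P = uadd numerator (uscale (- C) denominator)
    P-top : ∀ i → d ≤ i → ucoeff F P i ≈ - C * ucoeff F denominator i
    P-top i d≤i = trans (ucoeff-+ numerator _ i)
      (trans (+-cong (numerator-degree i d≤i) (ucoeff-scale (- C) denominator i)) (+-identityˡ _))
    P-leading : LeadingTerm d (- C) P
    P-leading =
      trans (P-top d ℕP.≤-refl) (trans (*-congˡ (proj₁ denominator-monic)) (*-identityʳ _)) ,
      λ i d<i → trans (P-top i (ℕP.<⇒≤ d<i)) (trans (*-congˡ (proj₂ denominator-monic i d<i)) (zeroʳ _))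
    -C≉0 : - C ≉ 0#
    -C≉0 -C≈0 = C≉0 (trans (sym (-‿involutive C)) (trans (-‿cong -C≈0) -0#≈0#))
    P-root : ∀ x → S x → f x ≈ C → ueval P x ≈ 0#
    P-root x x∈S fx≈C = begin
      ueval P x
        ≈⟨ ueval-+ numerator (uscale (- C) denominator) x ⟩
      ueval numerator x + ueval (uscale (- C) denominator) x
        ≈⟨ +-cong (sym (agrees x x∈S)) (ueval-scale (- C) denominator x) ⟩
      f x * ueval denominator x + - C * ueval denominator x
        ≈⟨ +-congʳ (*-congʳ fx≈C) ⟩
      C * ueval denominator x + - C * ueval denominator x
        ≈⟨ solve 2 (λ c d → c :* d :+ :- c :* d := con (ℤ.+ 0)) refl C _ ⟩
      0# ∎

  extensionMöbius : ∀ {t} → Vec Carrier t → Vec Bool t → Carrier → Carrier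
  extensionMöbius {t} α T x = möbius t (inverseForm α (β - x)) T

  extensionMöbius-rational : ∀ {t} (α : Vec Carrier t) → AllInS α → ∀ T →
    RationalOnS (pow2 t) (extensionMöbius α T)
  extensionMöbius-rational {t} α α∈S T = rational-cong signedSum≈
    (rational-sumCube t (λ U x → möbiusSign T U * (x - (β - subsetSum α U)) ⁻¹)
      (λ U → rational-pole (möbiusSign T U) (β - subsetSum α U) (β-x∉S (subsetSum∈S α α∈S U))))
    where
    pole : ∀ x → S x → ∀ U → inverseForm α (β - x) U ≈ (x - (β - subsetSum α U)) ⁻¹
    pole x x∈S U = ⁻¹-cong
      (solve 3 (λ σ b x → σ :- (b :- x) := x :- (b :- σ)) refl (subsetSum α U) β x)
      (x∈S⇒x-γ≉0 (subsetSum∈S α α∈S U) (β-x∉S x∈S))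
    signedSum≈ : ∀ x → S x →
      sumCube t (λ U → möbiusSign T U * (x - (β - subsetSum α U)) ⁻¹) ≈ extensionMöbius α T x
    signedSum≈ x x∈S = sym (trans (möbius-signedSum t _ T) (sumCube-cong t (λ U → *-congˡ (pole x x∈S U))))

  Good : ∀ {t} → Vec Carrier t → Set
  Good {t} α = AllInS α × (∀ T → möbius t (inverseForm α β) T ≉ 0#)

  -- The Möbius coefficient of a ∷ α at 0 ∷ T is that of α at T, and at 1 ∷ T it is
  -- extensionMöbius α T a minus that of α at T.
  good-∷ : ∀ {t} {α : Vec Carrier t} {a} → Good α → S a →
    (∀ T → extensionMöbius α T a ≉ möbius t (inverseForm α β) T) → Good (a ∷ α)
  good-∷ {t} {α} {a} (α∈S , möbius≉0) a∈S avoids = a∷α∈S , möbius′≉0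
    where
    a∷α∈S : AllInS (a ∷ α)
    a∷α∈S zero    = a∈S
    a∷α∈S (suc i) = α∈S i
    cons-false : ∀ U → inverseForm (a ∷ α) β (false ∷ U) ≈ inverseForm α β U
    cons-false U = ⁻¹-cong
      (solve 3 (λ a σ b → con (ℤ.+ 0) :* a :+ σ :- b := σ :- b) refl a (subsetSum α U) β)
      (x∈S⇒x-γ≉0 (subsetSum∈S (a ∷ α) a∷α∈S (false ∷ U)) β∉S)
    cons-true : ∀ U → inverseForm (a ∷ α) β (true ∷ U) ≈ inverseForm α (β - a) U
    cons-true U = ⁻¹-cong
      (solve 3 (λ a σ b → con (ℤ.+ 1) :* a :+ σ :- b := σ :- (b :- a)) refl a (subsetSum α U) β)
      (x∈S⇒x-γ≉0 (subsetSum∈S (a ∷ α) a∷α∈S (true ∷ U)) β∉S)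
    möbius′≉0 : ∀ T → möbius (suc t) (inverseForm (a ∷ α) β) T ≉ 0#
    möbius′≉0 (false ∷ T) ≈0 = möbius≉0 T (trans (sym (möbius-cong t cons-false T)) ≈0)
    möbius′≉0 (true  ∷ T) ≈0 = avoids T (x-y≈0⇒x≈y _ _ (trans (sym (trans
      (möbius-cong t (λ U → +-cong (cons-true U) (-‿cong (cons-false U))) T)
      (möbius-sub t (inverseForm α (β - a)) (inverseForm α β) T))) ≈0))

  -- Each T excludes at most 2^t values of a, and S has more than 2^t · 2^t elements.
  good-extension : ∀ {t} {α : Vec Carrier t} → pow2 t ℕ.* pow2 t < K → Good α → ∃ λ a → Good (a ∷ α)
  good-extension {t} {α} count good@(α∈S , möbius≉0) =
    let (i , avoids) = avoid S.enum S.enum-inj count excluded in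
    S.enum i , good-∷ good (S.enum-in i) (λ T hit →
      let (j , enumᵢ≈) = excluded-covers T (S.enum-in i) hit in avoids (indexCube t T) j enumᵢ≈)
    where
    excludedBy : ∀ T → ∃ λ (rs : Fin (pow2 t) → Carrier) →
      ∀ x → S x → extensionMöbius α T x ≈ möbius t (inverseForm α β) T → ∃ λ j → x ≈ rs j
    excludedBy T = rational-levelSet-bounded (extensionMöbius-rational α α∈S T) _ (möbius≉0 T)
    excluded : Fin (pow2 t) → Fin (pow2 t) → Carrier
    excluded i = proj₁ (excludedBy (enumCube t i))
    excluded-covers : ∀ T {x} → S x → extensionMöbius α T x ≈ möbius t (inverseForm α β) T →
      ∃ λ j → x ≈ excluded (indexCube t T) j
    excluded-covers T {x} x∈S hit =
      let (j , x≈rⱼ) = proj₂ (excludedBy T) x x∈S hit in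
      j , trans x≈rⱼ (reflexive (≡.cong (λ U → proj₁ (excludedBy U) j) (≡.sym (enumCube-index t T))))

  good-exists : ∀ t → (∀ t′ → t′ < t → pow2 t′ ℕ.* pow2 t′ < K) → ∃ (Good {t})
  good-exists zero    _     = [] , (λ ()) , λ { [] → ⁻¹-nonzero _ (x∈S⇒x-γ≉0 S.has0 β∉S) }
  good-exists (suc t) count =
    let (α , good) = good-exists t (λ t′ t′<t → count t′ (ℕP.m<n⇒m<1+n t′<t)) in
    let (a , good′) = good-extension (count t (ℕP.n<1+n t)) good in
    a ∷ α , good′

injective-nonSurjective : ∀ {m} (f : Fin m → Fin m) (i : Fin m) → (∀ l → f l ≢ i) →
  (∀ {l l′} → f l ≡ f l′ → l ≡ l′) → ⊥
injective-nonSurjective {suc m} f i misses f-injective = ℕP.<-irrefl ≡.refl (FinP.injective⇒≤ g-injective)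
  where
  g : Fin (suc m) → Fin m
  g l = punchOut (misses l ∘ ≡.sym)
  g-injective : ∀ {l l′} → g l ≡ g l′ → l ≡ l′
  g-injective {l} {l′} = f-injective ∘ FinP.punchOut-injective (misses l ∘ ≡.sym) (misses l′ ∘ ≡.sym)

-- Layer l reads the variable π ⟨$⟩ʳ l, so π ⟨$⟩ˡ v is the layer that reads v.
module BlockOrder (m₁ m₂ : ℕ) (π : Permutation′ (m₁ ℕ.+ m₂))
  (ordered : ∀ i j → π ⟨$⟩ˡ (i ↑ˡ m₂) Fin.< π ⟨$⟩ˡ (m₁ ↑ʳ j)) where

  ⟨$⟩ˡ-injective : ∀ {x y} → π ⟨$⟩ˡ x ≡ π ⟨$⟩ˡ y → x ≡ y
  ⟨$⟩ˡ-injective = Injection.injective (Inverse⇒Injection (Perm.flip π))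

  ⟨$⟩ʳ-injective : ∀ {x y} → π ⟨$⟩ʳ x ≡ π ⟨$⟩ʳ y → x ≡ y
  ⟨$⟩ʳ-injective = Injection.injective (Inverse⇒Injection π)

  -- If layer l < m₁ read a variable of the second block, all m₁ variables of the first
  -- block would have to fit into the l layers before it.
  leftLayer-readsLeft : ∀ l → ∃ λ i → π ⟨$⟩ʳ (l ↑ˡ m₂) ≡ i ↑ˡ m₂
  leftLayer-readsLeft l with splitAt m₁ (π ⟨$⟩ʳ (l ↑ˡ m₂)) in eq
  ... | inj₁ i = i , ≡.sym (FinP.splitAt⁻¹-↑ˡ eq)
  ... | inj₂ j = ⊥-elim (ℕP.<⇒≱ (FinP.toℕ<n l) (FinP.injective⇒≤ earlier-injective))
    where
    layer-j : π ⟨$⟩ˡ (m₁ ↑ʳ j) ≡ l ↑ˡ m₂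
    layer-j = ≡.trans (≡.cong (π ⟨$⟩ˡ_) (FinP.splitAt⁻¹-↑ʳ eq)) (Perm.inverseˡ π)
    before-l : ∀ i → Fin.toℕ (π ⟨$⟩ˡ (i ↑ˡ m₂)) < Fin.toℕ l
    before-l i = ≡.subst (Fin.toℕ (π ⟨$⟩ˡ (i ↑ˡ m₂)) <_)
      (≡.trans (≡.cong Fin.toℕ layer-j) (FinP.toℕ-↑ˡ l m₂)) (ordered i j)
    earlier : Fin m₁ → Fin (Fin.toℕ l)
    earlier i = Fin.fromℕ< (before-l i)
    earlier-injective : ∀ {i i′} → earlier i ≡ earlier i′ → i ≡ i′
    earlier-injective {i} {i′} eq′ = FinP.↑ˡ-injective m₂ i i′ (⟨$⟩ˡ-injective (FinP.toℕ-injective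
      (≡.trans (≡.sym (FinP.toℕ-fromℕ< (before-l i)))
        (≡.trans (≡.cong Fin.toℕ eq′) (FinP.toℕ-fromℕ< (before-l i′))))))

  leftVariable : Fin m₁ → Fin m₁
  leftVariable l = proj₁ (leftLayer-readsLeft l)

  -- Otherwise the first m₁ layers would read only m₁ − 1 distinct variables of the first block.
  rightLayer-readsRight : ∀ l → ∃ λ j → π ⟨$⟩ʳ (m₁ ↑ʳ l) ≡ m₁ ↑ʳ j
  rightLayer-readsRight l with splitAt m₁ (π ⟨$⟩ʳ (m₁ ↑ʳ l)) in eq
  ... | inj₂ j = j , ≡.sym (FinP.splitAt⁻¹-↑ʳ eq)
  ... | inj₁ i = ⊥-elim (injective-nonSurjective leftVariable i misses leftVariable-injective)
    where
    misses : ∀ l′ → leftVariable l′ ≢ i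
    misses l′ eq′ = ↑ˡ≢↑ʳ (⟨$⟩ʳ-injective (≡.trans (proj₂ (leftLayer-readsLeft l′))
      (≡.trans (≡.cong (_↑ˡ m₂) eq′) (FinP.splitAt⁻¹-↑ˡ eq))))
      where
      ↑ˡ≢↑ʳ : l′ ↑ˡ m₂ ≢ m₁ ↑ʳ l
      ↑ˡ≢↑ʳ e = ℕP.<⇒≢ (ℕP.<-≤-trans (FinP.toℕ<n l′) (ℕP.m≤m+n m₁ (Fin.toℕ l)))
        (≡.trans (≡.sym (FinP.toℕ-↑ˡ l′ m₂)) (≡.trans (≡.cong Fin.toℕ e) (FinP.toℕ-↑ʳ m₁ l)))
    leftVariable-injective : ∀ {l′ l″} → leftVariable l′ ≡ leftVariable l″ → l′ ≡ l″
    leftVariable-injective {l′} {l″} eq′ = FinP.↑ˡ-injective m₂ l′ l″ (⟨$⟩ʳ-injective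
      (≡.trans (proj₂ (leftLayer-readsLeft l′))
        (≡.trans (≡.cong (_↑ˡ m₂) eq′) (≡.sym (proj₂ (leftLayer-readsLeft l″))))))

  rightVariable : Fin m₂ → Fin m₂
  rightVariable l = proj₁ (rightLayer-readsRight l)

module LayerSplitting (F : Field) where
  open Field F hiding (zero)
  open FieldProperties F
  open import Relation.Binary.Reasoning.Setoid setoid

  data Prefix : ℕ → ℕ → ℕ → Set where
    []  : ∀ {a} → Prefix a a zero
    _∷_ : ∀ {a b c m} → (Fin a → Fin b → UPoly F) → Prefix b c m → Prefix a c (suc m)

  kronecker : ∀ {a} → Fin a → Fin a → Carrier
  kronecker zero    zero    = 1#
  kronecker zero    (suc _) = 0#
  kronecker (suc _) zero    = 0#
  kronecker (suc u) (suc v) = kronecker u v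

  sumFin-kronecker : ∀ a (u : Fin a) (g : Fin a → Carrier) → sumFin F a (λ v → kronecker u v * g v) ≈ g u
  sumFin-kronecker (suc a) zero    g = trans (+-cong (*-identityˡ _) (sumFin-zero a (λ _ → zeroˡ _))) (+-identityʳ _)
  sumFin-kronecker (suc a) (suc u) g = trans (+-cong (zeroˡ _) (sumFin-kronecker a u (g ∘ suc))) (+-identityˡ _)

  prefixCoeff : ∀ {a c m} → Prefix a c m → (Fin m → ℕ) → Fin a → Fin c → Carrier
  prefixCoeff []                  d u v = kronecker u v
  prefixCoeff (_∷_ {b = b} A Pr) d u v =
    sumFin F b (λ w → ucoeff F (A u w) (d zero) * prefixCoeff Pr (d ∘ suc) w v)

  prefixCoeff-cong : ∀ {a c m} (Pr : Prefix a c m) {d d′} → (∀ l → d l ≡ d′ l) →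
    ∀ u v → prefixCoeff Pr d u v ≈ prefixCoeff Pr d′ u v
  prefixCoeff-cong []                 d≗d′ u v = refl
  prefixCoeff-cong (_∷_ {b = b} A Pr) d≗d′ u v = sumFin-cong b (λ w →
    *-cong (reflexive (≡.cong (ucoeff F (A u w)) (d≗d′ zero))) (prefixCoeff-cong Pr (d≗d′ ∘ suc) w v))

  pathCoeff-cong : ∀ {a m} (L : Layers F a m) {d d′} → (∀ l → d l ≡ d′ l) →
    ∀ u → pathCoeff F L d u ≈ pathCoeff F L d′ u
  pathCoeff-cong end                  d≗d′ u = refl
  pathCoeff-cong (step {b = b} A L) d≗d′ u = sumFin-cong b (λ w →
    *-cong (reflexive (≡.cong (ucoeff F (A u w)) (d≗d′ zero))) (pathCoeff-cong L (d≗d′ ∘ suc) w))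

  record Split (a m₁ m₂ : ℕ) : Set where
    constructor split
    field
      {middle} : ℕ
      prefix   : Prefix a middle m₁
      suffix   : Layers F middle m₂

  splitLayers : ∀ {a} m₁ m₂ → Layers F a (m₁ ℕ.+ m₂) → Split a m₁ m₂
  splitLayers zero     m₂ L          = split [] L
  splitLayers (suc m₁) m₂ (step A L) = let split Pr R = splitLayers m₁ m₂ L in split (A ∷ Pr) R

  pathCoeff-split : ∀ {a} m₁ m₂ (L : Layers F a (m₁ ℕ.+ m₂)) d u →
    let open Split (splitLayers m₁ m₂ L) in
    pathCoeff F L d u ≈ sumFin F middle (λ v →
      prefixCoeff prefix (λ i → d (i ↑ˡ m₂)) u v * pathCoeff F suffix (λ j → d (m₁ ↑ʳ j)) v)
  pathCoeff-split {a} zero m₂ L d u = sym (sumFin-kronecker a u _)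
  pathCoeff-split (suc m₁) m₂ (step {b = b} A L) d u = begin
    sumFin F b (λ w → A₀ w * pathCoeff F L (d ∘ suc) w)
      ≈⟨ sumFin-cong b (λ w → *-congˡ (pathCoeff-split m₁ m₂ L (d ∘ suc) w)) ⟩
    sumFin F b (λ w → A₀ w * sumFin F middle (λ v → pre w v * suf v))
      ≈⟨ sumFin-cong b (λ w → sym (*-distribˡ-sumFin middle _ _)) ⟩
    sumFin F b (λ w → sumFin F middle (λ v → A₀ w * (pre w v * suf v)))
      ≈⟨ sumFin-swap b middle _ ⟩
    sumFin F middle (λ v → sumFin F b (λ w → A₀ w * (pre w v * suf v)))
      ≈⟨ sumFin-cong middle (λ v →
           trans (sumFin-cong b (λ w → sym (*-assoc _ _ _))) (*-distribʳ-sumFin b _ _)) ⟩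
    sumFin F middle (λ v → sumFin F b (λ w → A₀ w * pre w v) * suf v) ∎
    where
    open Split (splitLayers m₁ m₂ L)
    A₀ : Fin b → Carrier
    A₀ w = ucoeff F (A u w) (d zero)
    pre : Fin b → Fin middle → Carrier
    pre = prefixCoeff prefix (λ i → d (suc (i ↑ˡ m₂)))
    suf : Fin middle → Carrier
    suf = pathCoeff F suffix (λ j → d (suc (m₁ ↑ʳ j)))

  firstLayer≤width : ∀ {b m} (R : Layers F b m) → b ≤ width F R
  firstLayer≤width end        = ℕP.≤-refl
  firstLayer≤width (step A R) = ℕP.m≤m⊔n _ _

  middle≤width : ∀ {a} m₁ m₂ (L : Layers F a (m₁ ℕ.+ m₂)) →
    Split.middle (splitLayers m₁ m₂ L) ≤ width F L
  middle≤width zero     m₂ L          = firstLayer≤width L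
  middle≤width (suc m₁) m₂ (step A L) = ℕP.≤-trans (middle≤width m₁ m₂ L) (ℕP.m≤n⊔m _ _)

monomial : (F : Field) → ∀ {m} → (Fin m → Field.Carrier F) → (Fin m → ℕ) → Field.Carrier F
monomial F {m} x e = prodFin F m (λ i → pow F (x i) (e i))

module ROABPFactorisation (F : Field) (m₁ m₂ : ℕ) (π : Permutation′ (m₁ ℕ.+ m₂))
  (ordered : ∀ i j → π ⟨$⟩ˡ (i ↑ˡ m₂) Fin.< π ⟨$⟩ˡ (m₁ ↑ʳ j))
  (f : MPoly F (m₁ ℕ.+ m₂)) (L : ROABP F (m₁ ℕ.+ m₂)) (computes : Computes F L π f) where
  open Field F hiding (zero)
  open IntegerCoefficientSolver commutativeRing
  open FieldProperties F
  open LayerSplitting F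
  open BlockOrder m₁ m₂ π ordered
  open Split (splitLayers m₁ m₂ L) public using (middle)
  open Split (splitLayers m₁ m₂ L) using (prefix; suffix)
  open MPoly f using (D; coeff)
  open import Relation.Binary.Reasoning.Setoid setoid

  leftCoeff : (Fin m₁ → ℕ) → Fin middle → Carrier
  leftCoeff ex = prefixCoeff prefix (ex ∘ leftVariable) zero

  rightCoeff : (Fin m₂ → ℕ) → Fin middle → Carrier
  rightCoeff ey = pathCoeff F suffix (ey ∘ rightVariable)

  coeff-factorises : ∀ e →
    coeff e ≈ sumFin F middle (λ v →
      leftCoeff (λ i → e (i ↑ˡ m₂)) v * rightCoeff (λ j → e (m₁ ↑ʳ j)) v)
  coeff-factorises e = trans (sym (computes e)) (trans (pathCoeff-split m₁ m₂ L _ zero)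
    (sumFin-cong middle (λ v → *-cong
      (prefixCoeff-cong prefix (λ l → ≡.cong e (proj₂ (leftLayer-readsLeft l))) zero v)
      (pathCoeff-cong suffix (λ l → ≡.cong e (proj₂ (rightLayer-readsRight l))) v))))

  leftFactor : Fin middle → (Fin m₁ → Carrier) → Carrier
  leftFactor v x = sumExps F D m₁ (λ ex → leftCoeff ex v * monomial F x ex)

  rightFactor : Fin middle → (Fin m₂ → Carrier) → Carrier
  rightFactor v y = sumExps F D m₂ (λ ey → rightCoeff ey v * monomial F y ey)

  evalMP-factorises : ∀ pt x y → (∀ i → pt (i ↑ˡ m₂) ≡ x i) → (∀ j → pt (m₁ ↑ʳ j) ≡ y j) →
    evalMP F f pt ≈ sumFin F middle (λ v → leftFactor v x * rightFactor v y)
  evalMP-factorises pt x y pt≗x pt≗y = begin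
    sumExps F D (m₁ ℕ.+ m₂) (λ e → coeff e * monomial F pt e)
      ≈⟨ sumExps-cong D (m₁ ℕ.+ m₂) (λ e → trans (*-cong (coeff-factorises e) (monomial-++ e))
           (trans (sym (*-distribʳ-sumFin middle _ _))
                  (sumFin-cong middle (λ v → solve 4 (λ a b p q → (a :* b) :* (p :* q) := (a :* p) :* (b :* q))
                                                     refl _ _ _ _)))) ⟩
    sumExps F D (m₁ ℕ.+ m₂) (λ e → sumFin F middle (λ v →
      left v (λ i → e (i ↑ˡ m₂)) * right v (λ j → e (m₁ ↑ʳ j))))
      ≈⟨ sumExps-sumFin D (m₁ ℕ.+ m₂) middle _ ⟩
    sumFin F middle (λ v → sumExps F D (m₁ ℕ.+ m₂) (λ e →
      left v (λ i → e (i ↑ˡ m₂)) * right v (λ j → e (m₁ ↑ʳ j))))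
      ≈⟨ sumFin-cong middle (λ v → sumExps-++ D m₁ m₂ (left v) (right v) (left-extensional v)) ⟩
    sumFin F middle (λ v → leftFactor v x * rightFactor v y) ∎
    where
    left : Fin middle → (Fin m₁ → ℕ) → Carrier
    left v ex = leftCoeff ex v * monomial F x ex
    right : Fin middle → (Fin m₂ → ℕ) → Carrier
    right v ey = rightCoeff ey v * monomial F y ey
    monomial-++ : ∀ e →
      monomial F pt e ≈ monomial F x (λ i → e (i ↑ˡ m₂)) * monomial F y (λ j → e (m₁ ↑ʳ j))
    monomial-++ e = trans (prodFin-++ m₁ m₂ _) (*-cong
      (prodFin-cong m₁ (λ i → reflexive (≡.cong (λ z → pow F z (e (i ↑ˡ m₂))) (pt≗x i))))
      (prodFin-cong m₂ (λ j → reflexive (≡.cong (λ z → pow F z (e (m₁ ↑ʳ j))) (pt≗y j)))))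
    left-extensional : ∀ v → Extensional (left v)
    left-extensional v ex ex′ ex≗ex′ = *-cong
      (prefixCoeff-cong prefix (ex≗ex′ ∘ leftVariable) zero v)
      (prodFin-cong m₁ (λ i → reflexive (≡.cong (pow F (x i)) (ex≗ex′ i))))

module WidthLowerBound (F : Field) (_≟_ : ∀ x y → Dec (Field._≈_ F x y)) where
  open Field F hiding (zero)
  open FieldProperties F
  open MeetMatrix F
  open InverseForms F
  open LinearAlgebra F _≟_
  open LayerSplitting F using (middle≤width)
  open import Relation.Binary.Reasoning.Setoid setoid

  roABP-width-lowerBound : ∀ n (α : Vec Carrier n) β →
    (∀ U → subsetSum α U - β ≉ 0#) → (∀ T → möbius n (inverseForm α β) T ≉ 0#) →
    (f : MPoly F (n ℕ.+ n)) →
    (∀ (a : Fin (n ℕ.+ n) → Bool) → evalMP F f (bit F ∘ a) ≈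
       (sumFin F n (λ i → (lookup α i * bit F (a (i ↑ˡ n))) * bit F (a (n ↑ʳ i))) - β) ⁻¹) →
    (L : ROABP F (n ℕ.+ n)) (π : Permutation′ (n ℕ.+ n)) →
    (∀ i j → π ⟨$⟩ˡ (i ↑ˡ n) Fin.< π ⟨$⟩ˡ (n ↑ʳ j)) → Computes F L π f →
    pow2 n ≤ width F L
  roABP-width-lowerBound n α β denominator≉0 möbius≉0 f agrees L π ordered computes =
    ℕP.≤-trans (rowsIndependent⇒≤ M P Q M≈PQ (meetMatrix-rowsIndependent n _ möbius≉0)) (middle≤width n n L)
    where
    open ROABPFactorisation F n n π ordered f L computes
    M : Fin (pow2 n) → Vec Bool n → Carrier
    M i w = inverseForm α β (zipWith _∧_ (enumCube n i) w)
    P : Fin middle → Fin (pow2 n) → Carrier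
    P v i = leftFactor v (bit F ∘ lookup (enumCube n i))
    Q : Fin middle → Vec Bool n → Carrier
    Q v w = rightFactor v (bit F ∘ lookup w)
    M≈PQ : ∀ i w → M i w ≈ sumFin F middle (λ v → P v i * Q v w)
    M≈PQ i w = begin
      (subsetSum α (zipWith _∧_ u w) - β) ⁻¹
        ≈⟨ ⁻¹-cong (+-congʳ (sym sum≈subsetSum)) (denominator≉0 (zipWith _∧_ u w)) ⟩
      (sumFin F n (λ j → (lookup α j * bit F (a (j ↑ˡ n))) * bit F (a (n ↑ʳ j))) - β) ⁻¹
        ≈⟨ agrees a ⟨
      evalMP F f (bit F ∘ a)
        ≈⟨ evalMP-factorises _ _ _ (≡.cong (bit F) ∘ lookup-++ˡ u w) (≡.cong (bit F) ∘ lookup-++ʳ u w) ⟩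
      sumFin F middle (λ v → P v i * Q v w) ∎
      where
      u : Vec Bool n
      u = enumCube n i
      a : Fin (n ℕ.+ n) → Bool
      a = lookup (u ++ w)
      sum≈subsetSum : sumFin F n (λ j → (lookup α j * bit F (a (j ↑ˡ n))) * bit F (a (n ↑ʳ j)))
                        ≈ subsetSum α (zipWith _∧_ u w)
      sum≈subsetSum = trans
        (sumFin-cong n (λ j → reflexive
          (≡.cong₂ (λ b c → (lookup α j * bit F b) * bit F c) (lookup-++ˡ u w j) (lookup-++ʳ u w j))))
        (subsetSum-meet α u w)

pow2²<-bound : ∀ n K → 2 ℕ.^ (2 ℕ.* n) < K → ∀ t → t < n → pow2 t ℕ.* pow2 t < K
pow2²<-bound n K 2²ⁿ<K t t<n = ℕP.≤-<-trans pow2²≤2²ⁿ 2²ⁿ<K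
  where
  pow2²≤2²ⁿ : pow2 t ℕ.* pow2 t ≤ 2 ℕ.^ (2 ℕ.* n)
  pow2²≤2²ⁿ = ≡.subst (_≤ 2 ℕ.^ (2 ℕ.* n))
    (≡.trans (ℕP.^-distribˡ-+-* 2 t t) (≡.sym (≡.cong₂ ℕ._*_ (pow2≡2^ t) (pow2≡2^ t))))
    (ℕP.^-monoʳ-≤ 2 (ℕP.+-mono-≤ (ℕP.<⇒≤ t<n) (ℕP.≤-trans (ℕP.<⇒≤ t<n) (ℕP.m≤m+n n 0))))

open import Data.Nat using (_+_; _*_; _^_)
open import Data.Fin using () renaming (_<_ to _<ᶠ_)

mainTheorem14 :
  (n p k : ℕ) → Prime p →
  2 ^ (2 * n) < p ^ k → (∀ j → 2 ^ (2 * n) < p ^ j → k ≤ j) →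
  (F̃ : Field) → HasSize F̃ (p ^ (2 * k)) →
  (S : Field.Carrier F̃ → Set) → IsSubfieldOfSize F̃ S (p ^ k) →
  (β : Field.Carrier F̃) → ¬ S β →
  Σ (Fin n → Field.Carrier F̃) λ α → (∀ i → S (α i)) ×
    ((f : MPoly F̃ (n + n)) →
     (∀ (a : Fin (n + n) → Bool) →
        Field._≈_ F̃ (evalMP F̃ f (λ j → bit F̃ (a j)))
          (Field._⁻¹ F̃ (Field._-_ F̃
             (sumFin F̃ n (λ i → Field._*_ F̃ (Field._*_ F̃ (α i) (bit F̃ (a (i ↑ˡ n))))
                                              (bit F̃ (a (n ↑ʳ i)))))
             β))) →
     (L : ROABP F̃ (n + n)) (π : Permutation′ (n + n)) →
     (∀ i j → (π ⟨$⟩ˡ (i ↑ˡ n)) <ᶠ (π ⟨$⟩ˡ (n ↑ʳ j))) →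
     Computes F̃ L π f →
     2 ^ n ≤ width F̃ L)
mainTheorem14 n p k _ 2²ⁿ<pᵏ _ F̃ F̃-finite@(e , _ , e-surjective) S S-subfield β β∉S =
  lookup α , α∈S , λ f agrees L π ordered computes →
    ≡.subst (_≤ width F̃ L) (pow2≡2^ n)
      (roABP-width-lowerBound n α β (λ U → x∈S⇒x-γ≉0 (subsetSum∈S α α∈S U) β∉S) möbius≉0
        f agrees L π ordered computes)
  where
  open FieldProperties F̃ using (finite⇒decidable)
  open Field F̃ using (_≉_; 0#)
  open InverseForms F̃ using (inverseForm)
  open MeetMatrix F̃ using (möbius)
  open CoefficientChoice F̃ (finite⇒decidable F̃-finite) e e-surjective S S-subfield β β∉S
  open WidthLowerBound F̃ (finite⇒decidable F̃-finite)
  chosen : ∃ (Good {n})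
  chosen = good-exists n (pow2²<-bound n (p ^ k) 2²ⁿ<pᵏ)
  α : Vec (Field.Carrier F̃) n
  α = proj₁ chosen
  α∈S : AllInS α
  α∈S = proj₁ (proj₂ chosen)
  möbius≉0 : ∀ T → möbius n (inverseForm α β) T ≉ 0#
  möbius≉0 = proj₂ (proj₂ chosen)
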